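{- Let $\boldsymbol\alpha\in\mathbb{R}^{d+1}$, $\boldsymbol\beta\in\mathbb{R}^d$ be strictly increasing sequences and let $(M,N)\in\mathbb{R}^2_{>0}$ be an appropriate choice for $(\boldsymbol\alpha,\boldsymbol\beta)$. Then for each $(\pi,\tau)\in\mathfrak{S}_{d+1}\times\mathfrak{S}_d$, the point $v_{\pi,\tau}$ is a vertex of $\operatorname{Perm}(\boldsymbol\alpha,\boldsymbol\beta;M,N)$, and the normal cone of $\operatorname{Perm}(\boldsymbol\alpha,\boldsymbol\beta;M,N)$ at $v_{\pi,\tau}$ is $\sigma(\pi,\tau)$. Therefore the nested Braid fan $\mathrm{Br}_d^2$ is the normal fan of $\operatorname{Perm}(\boldsymbol\alpha,\boldsymbol\beta;M,N)$; hence $\mathrm{Br}_d^2$ is a complete projective fan in $W_d$.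
   Context: $W_d=\mathbb{R}^{d+1}/\mathbb{R}\mathbf{1}$ is dual to $V_d=\{\mathbf{x}\in\mathbb{R}^{d+1}:\sum x_i=0\}$ via $\langle\mathbf{w},\mathbf{x}\rangle=\sum w_ix_i$; for a polytope $P$ in a translate of $V_d$ and a face $F$, its normal cone is $\{\mathbf{w}\in W_d:\langle\mathbf{w},\mathbf{x}\rangle\ge\langle\mathbf{w},\mathbf{y}\rangle\ \forall\mathbf{x}\in F,\mathbf{y}\in P\}$, and the normal fan is the collection of normal cones of all faces. For $\pi\in\mathfrak{S}_{d+1}$: $\mathbf{f}^\pi_i=\mathbf{e}_{\pi^{ -1}(i+1)}-\mathbf{e}_{\pi^{ -1}(i)}$ and $(\Delta\mathbf{x})^\pi_i=x_{\pi^{ -1}(i+1)}-x_{\pi^{ -1}(i)}$ ($1\le i\le d$). $v_{\pi,\tau}=M\sum_{i=1}^{d+1}\alpha_i\mathbf{e}_{\pi^{ -1}(i)}+N\sum_{i=1}^d\beta_i\mathbf{f}^\pi_{\tau^{ -1}(i)}=\sum_{i=1}^{d+1}(M\alpha_i+N(\beta_{\tau(i-1)}-\beta_{\tau(i)}))\mathbf{e}_{\pi^{ -1}(i)}$ with $\beta_{\tau(0)}=\beta_{\tau(d+1)}=0$. $(M,N)$ is an appropriate choice if for every $\tau$ these coefficients strictly increase in $i$. $\operatorname{Perm}(\boldsymbol\alpha,\boldsymbol\beta;M,N)=\mathrm{conv}\{v_{\pi,\tau}\}$. $\sigma(\pi,\tau)=\{\mathbf{x}\in W_d: x_{\pi^{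 -1}(1)}\le\cdots\le x_{\pi^{ -1}(d+1)},\ (\Delta\mathbf{x})^\pi_{\tau^{ -1}(1)}\le\cdots\le(\Delta\mathbf{x})^\pi_{\tau^{ -1}(d)}\}$, and the nested Braid fan $\mathrm{Br}_d^2$ is the collection of all $\sigma(\pi,\tau)$ and their faces. -}

module Defs where

open import Level using (Level; _⊔_) renaming (suc to lsuc; zero to lzero)
open import Data.Nat as ℕ using (ℕ; zero; suc)
open import Data.Fin as Fin using (Fin; zero; suc; toℕ; inject₁)
open import Data.Fin.Permutation using (Permutation′; _⟨$⟩ʳ_; _⟨$⟩ˡ_)
open import Data.List using (List; []; _∷_)
import Data.List as Map
open import Data.List.Relation.Unary.All using (All)
open import Data.Sum using (_⊎_)
open import Data.Product using (Σ; ∃; ∃-syntax; _×_; _,_; proj₁; proj₂)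
open import Relation.Nullary using (¬_)
open import Relation.Binary.PropositionalEquality using (_≡_)
open import Relation.Binary.Structures using (IsStrictTotalOrder)
open import Algebra.Structures using (IsCommutativeRing)
open import Function.Bundles using (_⇔_)

-- Ordered fields (the real numbers ℝ being the intended model).
-- agda-stdlib has no reals; all statements are made for an arbitrary
-- ordered field, which in particular covers ℝ.

record OrderedField (c : Level) : Set (lsuc c) where
  infix  4 _<_ _≤_
  infixl 6 _+_ _-_
  infixl 7 _*_
  field
    Carrier   : Set c
    _+_ _*_   : Carrier → Carrier → Carrier
    -_        : Carrier → Carrier
    0# 1#     : Carrier
    _<_       : Carrier → Carrier → Set c
    isCommutativeRing : IsCommutativeRing _≡_ _+_ _*_ -_ 0# 1#
    inverse   : ∀ x → ¬ (x ≡ 0#) → ∃[ y ] (x * y ≡ 1#)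
    nontrivial : ¬ (0# ≡ 1#)
    isStrictTotalOrder : IsStrictTotalOrder {A = Carrier} _≡_ _<_
    +-mono-<  : ∀ {x y} z → x < y → x + z < y + z
    *-pos     : ∀ {x y} → 0# < x → 0# < y → 0# < x * y

  _-_ : Carrier → Carrier → Carrier
  x - y = x + (- y)

  _≤_ : Carrier → Carrier → Set c
  x ≤ y = (x < y) ⊎ (x ≡ y)

module _ {c : Level} (K : OrderedField c) where
  open OrderedField K

  Pt : ℕ → Set c
  Pt n = Fin n → Carrier

  sumF : ∀ {n} → (Fin n → Carrier) → Carrier
  sumF {zero}  f = 0#
  sumF {suc n} f = f zero + sumF (λ i → f (suc i))

  ⟨_,_⟩ : ∀ {n} → Pt n → Pt n → Carrier
  ⟨ w , x ⟩ = sumF (λ i → w i * x i)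

  _≈ₚ_ : ∀ {n} → Pt n → Pt n → Set c
  x ≈ₚ y = ∀ i → x i ≡ y i

  StrictlyIncreasing : ∀ {n} → (Fin n → Carrier) → Set c
  StrictlyIncreasing f = ∀ i j → i Fin.< j → f i < f j

  -- f at a natural-number index, 0 outside the range
  at : ∀ {n} → (Fin n → Carrier) → ℕ → Carrier
  at {zero}  f k       = 0#
  at {suc n} f zero    = f zero
  at {suc n} f (suc k) = at (λ i → f (suc i)) k

  module Nested {d : ℕ} (α : Fin (suc d) → Carrier) (β : Fin d → Carrier)
                (M N : Carrier) where

    -- (0-based) B k = β_{τ(k)} in the paper's 1-based indexing,
    -- with β_{τ(0)} = β_{τ(d+1)} = 0
    Bτ : Permutation′ d → ℕ → Carrier
    Bτ τ zero    = 0#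
    Bτ τ (suc k) = at (λ j → β (τ ⟨$⟩ʳ j)) k

    -- coefficient of e_{π⁻¹(i)} in v_{π,τ} (i 0-based, = paper's i+1):
    --   M α_i + N (β_{τ(i-1)} - β_{τ(i)})
    coeff : Permutation′ d → Fin (suc d) → Carrier
    coeff τ i = M * α i + N * (Bτ τ (toℕ i) - Bτ τ (suc (toℕ i)))

    -- v_{π,τ} = Σ_i coeff_i e_{π⁻¹(i)}, so its j-th coordinate is coeff_{π(j)}
    v : Permutation′ (suc d) → Permutation′ d → Pt (suc d)
    v π τ j = coeff τ (π ⟨$⟩ʳ j)

    Appropriate : Set c
    Appropriate = ∀ τ → StrictlyIncreasing (coeff τ)

    -- Perm(α,β;M,N) = conv{v_{π,τ}} : x is a convex combination
    -- Σ λ_k v_{π_k,τ_k} with λ_k ≥ 0, Σ λ_k = 1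
    sumL : List (Carrier × Permutation′ (suc d) × Permutation′ d) → Carrier
    sumL []                   = 0#
    sumL ((λ' , _ , _) ∷ ws) = λ' + sumL ws

    combL : List (Carrier × Permutation′ (suc d) × Permutation′ d) → Pt (suc d)
    combL []                  j = 0#
    combL ((λ' , π , τ) ∷ ws) j = λ' * v π τ j + combL ws j

    PermPoly : Pt (suc d) → Set c
    PermPoly x = ∃[ ws ] (All (λ { (λ' , _ , _) → 0# ≤ λ' }) ws
                          × sumL ws ≡ 1# × x ≈ₚ combL ws)

  -- Linear functionals on W_d are represented by vectors w ∈ ℝ^{d+1};
  -- all sets of functionals below are invariant under w ↦ w + t·1
  -- when the polytope lies in a translate of V_d.

  Maximises : ∀ {n} → (Pt n → Set c) → Pt n → Pt n → Set c
  Maximises P w x = P x × (∀ y → P y → ⟨ w , y ⟩ ≤ ⟨ w , x ⟩)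

  IsFace : ∀ {n} → (Pt n → Set c) → (Pt n → Set c) → Set c
  IsFace P F = ∃[ w ] (∀ x → F x ⇔ Maximises P w x)

  IsVertex : ∀ {n} → (Pt n → Set c) → Pt n → Set c
  IsVertex P p = IsFace P (λ x → x ≈ₚ p)

  NormalCone : ∀ {n} → (Pt n → Set c) → (Pt n → Set c) → Pt n → Set c
  NormalCone P F w = ∀ x → F x → ∀ y → P y → ⟨ w , y ⟩ ≤ ⟨ w , x ⟩

  InNormalFan : ∀ {n} → (Pt n → Set c) → (Pt n → Set c) → Set (lsuc c)
  InNormalFan P C = ∃[ F ] (IsFace P F × (∀ w → C w ⇔ NormalCone P F w))

  Δ : ∀ {d} → Permutation′ (suc d) → Pt (suc d) → Fin d → Carrier
  Δ π x i = x (π ⟨$⟩ˡ suc i) - x (π ⟨$⟩ˡ inject₁ i)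

  σ : ∀ {d} → Permutation′ (suc d) → Permutation′ d → Pt (suc d) → Set c
  σ π τ x = (∀ i j → i Fin.< j → x (π ⟨$⟩ˡ i) ≤ x (π ⟨$⟩ˡ j))
          × (∀ i j → i Fin.< j → Δ π x (τ ⟨$⟩ˡ i) ≤ Δ π x (τ ⟨$⟩ˡ j))

  -- C is a face of the cone S in W_d: C = S ∩ u^⊥ for a linear functional
  -- u on W_d (i.e. u ∈ V_d, Σ u_i = 0) that is nonnegative on S
  IsConeFace : ∀ {n} → (Pt n → Set c) → (Pt n → Set c) → Set c
  IsConeFace S C = ∃[ u ] (sumF u ≡ 0#
                           × (∀ w → S w → 0# ≤ ⟨ u , w ⟩)
                           × (∀ w → C w ⇔ (S w × ⟨ u , w ⟩ ≡ 0#)))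

  InBr² : (d : ℕ) → (Pt (suc d) → Set c) → Set c
  InBr² d C = ∃[ π ] ∃[ τ ] IsConeFace (σ {d} π τ) C

  SameFan : ∀ {n a b} → ((Pt n → Set c) → Set a)
                  → ((Pt n → Set c) → Set b) → Set (lsuc c ⊔ a ⊔ b)
  SameFan 𝒜 ℬ = ∀ C → 𝒜 C ⇔ ℬ C

  Complete : ∀ {n a} → ((Pt n → Set c) → Set a) → Set (lsuc c ⊔ a)
  Complete 𝒜 = ∀ w → ∃[ C ] (𝒜 C × C w)

  Conv : ∀ {n} → List (Pt n) → Pt n → Set c
  Conv {n} ps x = ∃[ ws ] (Map.map proj₂ ws ≡ ps
                           × All (λ lp → 0# ≤ proj₁ lp) ws
                           × sum ws ≡ 1# × x ≈ₚ comb ws)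
    where
      sum : List (Carrier × Pt n) → Carrier
      sum []             = 0#
      sum ((l , _) ∷ ws) = l + sum ws
      comb : List (Carrier × Pt n) → Pt n
      comb []             j = 0#
      comb ((l , p) ∷ ws) j = l * p j + comb ws j

  -- a fan is projective if it is the normal fan of a polytope
  -- (the convex hull of finitely many points in a translate of V_d)
  Projective : ∀ {n a} → ((Pt n → Set c) → Set a) → Set (lsuc c ⊔ a)
  Projective {n} 𝒜 = ∃[ ps ] ∃[ s ] (All (λ p → sumF p ≡ s) ps
                                   × SameFan 𝒜 (InNormalFan (Conv ps)))

module Submission where

-- For fixed (π,τ) the cone σ(π,τ) is simplicial: it is cut out by
-- d "facet" functionals (the first gap of the π-sorted coordinates and the
-- increments of the τ-sorted gaps), and two Abel summations give
--   ⟨w,z⟩ = Σ_j facet_j(w) · dualCoord_j(z)   for Σ z = 0.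
-- (1) For w ∈ σ(π,τ) the vertex v_{π,τ} maximises ⟨w,-⟩ over all vertices
--     (rearrangement inequality, once for coordinates, once for gaps).
-- (2) Across each facet j there is a neighbouring vertex with
--     ⟨w,v⟩ - ⟨w,v_j⟩ = (positive) · facet_j(w); so maximality forces w ∈ σ.
-- (3) Maximising ⟨w,-⟩ over the finite list of vertices shows completeness.
-- (4) For any set Q spanned by the vertices (Perm(α,β;M,N), or conv of the
--     vertex list) complementary slackness in the facet coordinates gives
--     the vertex property, the normal cones of all faces, and both
--     inclusions between Br²_d and the normal fan of Q.

open import Defs
open import Level using (Level; _⊔_)
open import Data.Nat as ℕ using (ℕ; zero; suc; z≤n; s≤s)
import Data.Nat.Properties as ℕP
open import Data.Integer as ℤ using (ℤ; -[1+_]; _⊖_; ∣_∣; sign; _◃_) renaming (+_ to pos)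
import Data.Integer.Properties as ℤP
open import Data.Sign as Sign using (Sign)
open import Data.Fin as Fin using (Fin; zero; suc; toℕ; inject₁; punchIn; punchOut)
import Data.Fin.Properties as FinP
open import Data.Fin.Permutation as Perm
  using (Permutation′; _⟨$⟩ʳ_; _⟨$⟩ˡ_; remove; lift₀; lift₀-cong; lift₀-remove; punchIn-permute; inverseˡ; inverseʳ)
import Data.Fin.Permutation.Components as PC
open import Data.Maybe using (Maybe; just; nothing)
open import Data.Sum using (_⊎_; inj₁; inj₂; [_,_]′)
open import Data.Product using (Σ; _×_; _,_; proj₁; proj₂)
open import Data.Empty using (⊥-elim)
open import Data.List using (List; []; _∷_; map; concatMap; allFin; cartesianProduct)
import Data.List.Properties as ListP
open import Data.List.Relation.Unary.All as All using (All; []; _∷_)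
import Data.List.Relation.Unary.All.Properties as AllP
open import Data.List.Relation.Unary.Any as Any using (Any; here; there)
open import Data.List.Relation.Unary.Any.Properties using (concatMap⁺; map⁺; cartesianProduct⁺)
open import Data.List.Membership.Propositional.Properties using (∈-allFin)
open import Function.Base using (id)
open import Function.Bundles using (_⇔_; mk⇔; Equivalence)
import Function.Properties.Equivalence as ⇔
open import Relation.Nullary using (¬_; yes; no; Dec)
open import Relation.Nullary.Decidable using (dec-true; dec-false)
open import Relation.Unary using (_⟨×⟩_)
open import Relation.Binary.PropositionalEquality
open import Relation.Binary.Definitions using (tri<; tri≈; tri>)
open import Relation.Binary.Structures using (IsStrictTotalOrder; IsTotalOrder)
open import Relation.Binary.Bundles using (StrictPartialOrder)
import Relation.Binary.Construct.StrictToNonStrict as StrictToNonStrict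
import Relation.Binary.Reasoning.StrictPartialOrder
open import Algebra.Bundles using (CommutativeRing)
import Algebra.Solver.Ring.AlmostCommutativeRing as ACR

module OrderedFieldTheory {c : Level} (K : OrderedField c) where
  open OrderedField K public

  commutativeRing : CommutativeRing c c
  commutativeRing = record { isCommutativeRing = isCommutativeRing }

  open CommutativeRing commutativeRing public
    using (+-assoc; +-comm; *-assoc; *-comm; +-identityˡ; +-identityʳ; *-identityˡ; *-identityʳ;
           -‿inverseʳ; distribˡ; zeroˡ; zeroʳ; ring; +-abelianGroup)
  open import Algebra.Properties.Ring ring public using (-‿distribʳ-*; -‿involutive; -0#≈0#; -1*x≈-x)
  open import Algebra.Properties.AbelianGroup +-abelianGroup public using (⁻¹-∙-comm)
  open import Algebra.Properties.Semiring.Mult (CommutativeRing.semiring commutativeRing)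
    using (×-homo-+; ×1-homo-*) renaming (_×_ to _times_)

  -- The canonical ring homomorphism ℤ → K.  It lets the stdlib ring
  -- solver normalise polynomial identities over K with integer coefficients.
  ιℕ : ℕ → Carrier
  ιℕ n = n times 1#

  ι : ℤ → Carrier
  ι (pos n)  = ιℕ n
  ι -[1+ n ] = - ιℕ (suc n)

  cancel-one : ∀ a b → a - b ≡ (1# + a) - (1# + b)
  cancel-one a b = begin
      a - b                       ≡⟨ sym (+-identityˡ _) ⟩
      0# + (a - b)                ≡⟨ cong (_+ (a - b)) (sym (-‿inverseʳ 1#)) ⟩
      (1# - 1#) + (a + - b)       ≡⟨ +-assoc 1# (- 1#) _ ⟩
      1# + (- 1# + (a + - b))     ≡⟨ cong (1# +_) (sym (+-assoc (- 1#) a (- b))) ⟩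
      1# + ((- 1# + a) + - b)     ≡⟨ cong (λ z → 1# + (z + - b)) (+-comm (- 1#) a) ⟩
      1# + ((a + - 1#) + - b)     ≡⟨ cong (1# +_) (+-assoc a (- 1#) (- b)) ⟩
      1# + (a + (- 1# + - b))     ≡⟨ sym (+-assoc 1# a _) ⟩
      (1# + a) + (- 1# + - b)     ≡⟨ cong ((1# + a) +_) (⁻¹-∙-comm 1# b) ⟩
      (1# + a) - (1# + b)         ∎
    where open ≡-Reasoning

  ι-⊖ : ∀ m n → ι (m ⊖ n) ≡ ιℕ m - ιℕ n
  ι-⊖ m zero = trans (cong ι (ℤP.⊖-≥ {m} {0} ℕ.z≤n))
                     (sym (trans (cong (ιℕ m +_) -0#≈0#) (+-identityʳ _)))
  ι-⊖ zero (suc n) = trans (cong ι (ℤP.⊖-< {0} {suc n} (ℕ.s≤s ℕ.z≤n))) (sym (+-identityˡ _))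
  ι-⊖ (suc m) (suc n) = trans (cong ι (ℤP.[1+m]⊖[1+n]≡m⊖n m n)) (trans (ι-⊖ m n) (cancel-one _ _))

  ι-+ : ∀ i j → ι (i ℤ.+ j) ≡ ι i + ι j
  ι-+ (pos m)  (pos n)  = ×-homo-+ 1# m n
  ι-+ (pos m)  -[1+ n ] = ι-⊖ m (suc n)
  ι-+ -[1+ m ] (pos n)  = trans (ι-⊖ n (suc m)) (+-comm _ _)
  ι-+ -[1+ m ] -[1+ n ] = begin
      - ιℕ (suc (suc (m ℕ.+ n)))    ≡⟨ cong (λ k → - ιℕ k) (sym (ℕP.+-suc (suc m) n)) ⟩
      - ιℕ (suc m ℕ.+ suc n)        ≡⟨ cong -_ (×-homo-+ 1# (suc m) (suc n)) ⟩
      - (ιℕ (suc m) + ιℕ (suc n))   ≡⟨ sym (⁻¹-∙-comm _ _) ⟩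
      - ιℕ (suc m) + - ιℕ (suc n)   ∎
    where open ≡-Reasoning

  ι-neg : ∀ i → ι (ℤ.- i) ≡ - ι i
  ι-neg (pos zero)    = sym -0#≈0#
  ι-neg (pos (suc n)) = refl
  ι-neg -[1+ n ]      = sym (-‿involutive _)

  signValue : Sign → Carrier
  signValue Sign.+ = 1#
  signValue Sign.- = - 1#

  signValue-* : ∀ s t → signValue (s Sign.* t) ≡ signValue s * signValue t
  signValue-* Sign.+ t      = sym (*-identityˡ _)
  signValue-* Sign.- Sign.+ = sym (*-identityʳ _)
  signValue-* Sign.- Sign.- = begin
      1#              ≡⟨ sym (-‿involutive _) ⟩
      - - 1#          ≡⟨ cong -_ (sym (-1*x≈-x 1#)) ⟩
      - (- 1# * 1#)   ≡⟨ -‿distribʳ-* _ _ ⟩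
      - 1# * - 1#     ∎
    where open ≡-Reasoning

  ι-◃ : ∀ s n → ι (s ◃ n) ≡ signValue s * ιℕ n
  ι-◃ s      zero    = sym (zeroʳ _)
  ι-◃ Sign.+ (suc n) = sym (*-identityˡ _)
  ι-◃ Sign.- (suc n) = sym (-1*x≈-x _)

  ι-signAbs : ∀ i → ι i ≡ signValue (sign i) * ιℕ ∣ i ∣
  ι-signAbs i = trans (cong ι (sym (ℤP.◃-inverse i))) (ι-◃ (sign i) ∣ i ∣)

  ι-* : ∀ i j → ι (i ℤ.* j) ≡ ι i * ι j
  ι-* i j = begin
      ι (i ℤ.* j)                               ≡⟨ ι-◃ (sign i Sign.* sign j) (∣ i ∣ ℕ.* ∣ j ∣) ⟩
      signValue (sign i Sign.* sign j) * ιℕ (∣ i ∣ ℕ.* ∣ j ∣)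
        ≡⟨ cong₂ _*_ (signValue-* (sign i) (sign j)) (×1-homo-* ∣ i ∣ ∣ j ∣) ⟩
      (s * t) * (a * b)                         ≡⟨ middle-swap ⟩
      (s * a) * (t * b)                         ≡⟨ cong₂ _*_ (sym (ι-signAbs i)) (sym (ι-signAbs j)) ⟩
      ι i * ι j                                 ∎
    where
      open ≡-Reasoning
      s = signValue (sign i)
      t = signValue (sign j)
      a = ιℕ ∣ i ∣
      b = ιℕ ∣ j ∣
      middle-swap : (s * t) * (a * b) ≡ (s * a) * (t * b)
      middle-swap = begin
        (s * t) * (a * b)   ≡⟨ *-assoc s t _ ⟩
        s * (t * (a * b))   ≡⟨ cong (s *_) (sym (*-assoc t a b)) ⟩
        s * ((t * a) * b)   ≡⟨ cong (λ z → s * (z * b)) (*-comm t a) ⟩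
        s * ((a * t) * b)   ≡⟨ cong (s *_) (*-assoc a t b) ⟩
        s * (a * (t * b))   ≡⟨ sym (*-assoc s a _) ⟩
        (s * a) * (t * b)   ∎

  ℤ-homomorphism : CommutativeRing.rawRing ℤP.+-*-commutativeRing
                     ACR.-Raw-AlmostCommutative⟶ ACR.fromCommutativeRing commutativeRing
  ℤ-homomorphism = record
    { ⟦_⟧ = ι ; +-homo = ι-+ ; *-homo = ι-* ; -‿homo = ι-neg
    ; 0-homo = refl ; 1-homo = +-identityʳ 1# }

  ι-equal? : ∀ a b → Maybe (ι a ≡ ι b)
  ι-equal? a b with a ℤ.≟ b
  ... | yes refl = just refl
  ... | no _     = nothing

  open import Algebra.Solver.Ring (CommutativeRing.rawRing ℤP.+-*-commutativeRing)
    (ACR.fromCommutativeRing commutativeRing) ℤ-homomorphism ι-equal? public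

  -- Order theory.  The field's _≤_ is the reflexive closure of _<_, so the
  -- stdlib's strict-to-non-strict construction applies verbatim.
  open IsStrictTotalOrder isStrictTotalOrder public
    using (_≟_) renaming (trans to <-trans; irrefl to <-irrefl; compare to <-compare)

  ≤-isTotalOrder : IsTotalOrder _≡_ _≤_
  ≤-isTotalOrder = StrictToNonStrict.isTotalOrder _≡_ _<_ isStrictTotalOrder

  open IsTotalOrder ≤-isTotalOrder public
    using () renaming (refl to ≤-refl; trans to ≤-trans; antisym to ≤-antisym; total to ≤-total)

  <-strictPartialOrder : StrictPartialOrder c c c
  <-strictPartialOrder = record
    { isStrictPartialOrder = IsStrictTotalOrder.isStrictPartialOrder isStrictTotalOrder }

  module ≤-Reasoning = Relation.Binary.Reasoning.StrictPartialOrder <-strictPartialOrder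

  <⇒≤ : ∀ {x y} → x < y → x ≤ y
  <⇒≤ = inj₁

  ≡⇒≤ : ∀ {x y} → x ≡ y → x ≤ y
  ≡⇒≤ = inj₂

  ≤-<-trans : ∀ {x y z} → x ≤ y → y < z → x < z
  ≤-<-trans (inj₁ x<y) y<z = <-trans x<y y<z
  ≤-<-trans (inj₂ refl) y<z = y<z

  <⇒≢ : ∀ {x y} → x < y → ¬ (x ≡ y)
  <⇒≢ x<y x≡y = <-irrefl x≡y x<y

  +-monoˡ-< : ∀ {x y} z → x < y → z + x < z + y
  +-monoˡ-< {x} {y} z x<y = subst₂ _<_ (+-comm x z) (+-comm y z) (+-mono-< z x<y)

  +-monoʳ-≤ : ∀ {x y} z → x ≤ y → x + z ≤ y + z
  +-monoʳ-≤ z (inj₁ x<y) = inj₁ (+-mono-< z x<y)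
  +-monoʳ-≤ z (inj₂ refl) = ≤-refl

  +-monoˡ-≤ : ∀ {x y} z → x ≤ y → z + x ≤ z + y
  +-monoˡ-≤ z (inj₁ x<y) = inj₁ (+-monoˡ-< z x<y)
  +-monoˡ-≤ z (inj₂ refl) = ≤-refl

  +-mono-≤ : ∀ {a b x y} → a ≤ b → x ≤ y → a + x ≤ b + y
  +-mono-≤ {b = b} {x} a≤b x≤y = ≤-trans (+-monoʳ-≤ x a≤b) (+-monoˡ-≤ b x≤y)

  x+[y-x]≡y : ∀ x y → x + (y - x) ≡ y
  x+[y-x]≡y = solve 2 (λ x y → x :+ (y :- x) := y) refl

  x-y≡0⇒x≡y : ∀ {x y} → x - y ≡ 0# → x ≡ y
  x-y≡0⇒x≡y {x} {y} x-y≡0 = begin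
      x              ≡⟨ solve 2 (λ x y → x := y :+ (x :- y)) refl x y ⟩
      y + (x - y)    ≡⟨ cong (y +_) x-y≡0 ⟩
      y + 0#         ≡⟨ +-identityʳ y ⟩
      y              ∎
    where open ≡-Reasoning

  x≡y⇒x-y≡0 : ∀ {x y} → x ≡ y → x - y ≡ 0#
  x≡y⇒x-y≡0 {x} refl = -‿inverseʳ x

  ≤⇒0≤- : ∀ {x y} → x ≤ y → 0# ≤ y - x
  ≤⇒0≤- {x} x≤y = subst₂ _≤_ (-‿inverseʳ x) refl (+-monoʳ-≤ (- x) x≤y)

  <⇒0<- : ∀ {x y} → x < y → 0# < y - x
  <⇒0<- {x} x<y = subst₂ _<_ (-‿inverseʳ x) refl (+-mono-< (- x) x<y)

  0≤-⇒≤ : ∀ {x y} → 0# ≤ y - x → x ≤ y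
  0≤-⇒≤ {x} {y} 0≤y-x = subst₂ _≤_ (+-identityʳ x) (x+[y-x]≡y x y) (+-monoˡ-≤ x 0≤y-x)

  0<-⇒< : ∀ {x y} → 0# < y - x → x < y
  0<-⇒< {x} {y} 0<y-x = subst₂ _<_ (+-identityʳ x) (x+[y-x]≡y x y) (+-monoˡ-< x 0<y-x)

  neg-antimono-< : ∀ {x y} → x < y → - y < - x
  neg-antimono-< {x} {y} x<y =
    subst₂ _<_ (solve 2 (λ x y → x :+ (:- x :+ :- y) := :- y) refl x y)
               (solve 2 (λ x y → y :+ (:- x :+ :- y) := :- x) refl x y)
               (+-mono-< (- x + - y) x<y)

  neg-reflects-≤ : ∀ {x y} → - x ≤ - y → y ≤ x
  neg-reflects-≤ {x} {y} -x≤-y =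
    0≤-⇒≤ (subst (0# ≤_) (solve 2 (λ x y → (:- y) :- (:- x) := x :- y) refl x y) (≤⇒0≤- -x≤-y))

  -- 1 > 0: otherwise -1 > 0 and then 1 = (-1)(-1) > 0 as well.
  0<1 : 0# < 1#
  0<1 with <-compare 0# 1#
  ... | tri< 0<1 _ _ = 0<1
  ... | tri≈ _ 0≡1 _ = ⊥-elim (nontrivial 0≡1)
  ... | tri> _ _ 1<0 = ⊥-elim (<-irrefl refl (<-trans 1<0 0<[-1][-1]))
    where
      0<-1 : 0# < - 1#
      0<-1 = subst (_< - 1#) -0#≈0# (neg-antimono-< 1<0)
      0<[-1][-1] : 0# < 1#
      0<[-1][-1] = subst (0# <_) (trans (solve 1 (λ x → :- x :* :- x := x :* x) refl 1#) (*-identityˡ 1#))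
                                 (*-pos 0<-1 0<-1)

  *-nonneg : ∀ {a b} → 0# ≤ a → 0# ≤ b → 0# ≤ a * b
  *-nonneg (inj₁ 0<a) (inj₁ 0<b) = inj₁ (*-pos 0<a 0<b)
  *-nonneg {a} (inj₁ _) (inj₂ refl) = inj₂ (sym (zeroʳ a))
  *-nonneg {b = b} (inj₂ refl) _ = inj₂ (sym (zeroˡ b))

  a[y-x]≡ay-ax : ∀ a x y → a * (y - x) ≡ a * y - a * x
  a[y-x]≡ay-ax = solve 3 (λ a x y → a :* (y :- x) := a :* y :- a :* x) refl

  *-monoˡ-≤ : ∀ {a x y} → 0# ≤ a → x ≤ y → a * x ≤ a * y
  *-monoˡ-≤ {a} {x} {y} 0≤a x≤y =
    0≤-⇒≤ (subst (0# ≤_) (a[y-x]≡ay-ax a x y) (*-nonneg 0≤a (≤⇒0≤- x≤y)))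

  *-monoˡ-< : ∀ {a x y} → 0# < a → x < y → a * x < a * y
  *-monoˡ-< {a} {x} {y} 0<a x<y =
    0<-⇒< (subst (0# <_) (a[y-x]≡ay-ax a x y) (*-pos 0<a (<⇒0<- x<y)))

  pos-*-nonneg⇒nonneg : ∀ {a b} → 0# < a → 0# ≤ a * b → 0# ≤ b
  pos-*-nonneg⇒nonneg {a} {b} 0<a 0≤ab with <-compare b 0#
  ... | tri< b<0 _ _ = ⊥-elim (<-irrefl refl (≤-<-trans 0≤ab (subst (a * b <_) (zeroʳ a) (*-monoˡ-< 0<a b<0))))
  ... | tri≈ _ b≡0 _ = inj₂ (sym b≡0)
  ... | tri> _ _ 0<b = inj₁ 0<b

  nonzero-*-zero : ∀ {a b} → ¬ (a ≡ 0#) → a * b ≡ 0# → b ≡ 0#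
  nonzero-*-zero {a} {b} a≢0 ab≡0 with inverse a a≢0
  ... | a⁻¹ , aa⁻¹≡1 = begin
      b               ≡⟨ sym (*-identityˡ b) ⟩
      1# * b          ≡⟨ cong (_* b) (sym aa⁻¹≡1) ⟩
      a * a⁻¹ * b     ≡⟨ solve 3 (λ a a' b → a :* a' :* b := a' :* (a :* b)) refl a a⁻¹ b ⟩
      a⁻¹ * (a * b)   ≡⟨ cong (a⁻¹ *_) ab≡0 ⟩
      a⁻¹ * 0#        ≡⟨ zeroʳ a⁻¹ ⟩
      0#              ∎
    where open ≡-Reasoning

  *-zero : ∀ {a b} → a * b ≡ 0# → a ≡ 0# ⊎ b ≡ 0#
  *-zero {a} ab≡0 with a ≟ 0#
  ... | yes a≡0 = inj₁ a≡0
  ... | no a≢0 = inj₂ (nonzero-*-zero a≢0 ab≡0)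

  nonneg-+-zero : ∀ {a b} → 0# ≤ a → 0# ≤ b → a + b ≡ 0# → a ≡ 0# × b ≡ 0#
  nonneg-+-zero {a} {b} (inj₂ refl) _ a+b≡0 = refl , trans (sym (+-identityˡ b)) a+b≡0
  nonneg-+-zero {a} {b} (inj₁ 0<a) 0≤b a+b≡0 =
    ⊥-elim (<-irrefl (sym a+b≡0) (≤-<-trans (subst (0# ≤_) (sym (+-identityˡ b)) 0≤b) (+-mono-< b 0<a)))

  isZero : Carrier → Carrier
  isZero x with x ≟ 0#
  ... | yes _ = 1#
  ... | no _  = 0#

  isZero-nonneg : ∀ x → 0# ≤ isZero x
  isZero-nonneg x with x ≟ 0#
  ... | yes _ = <⇒≤ 0<1
  ... | no _  = ≤-refl

  isZero-yes : ∀ {x} → x ≡ 0# → isZero x ≡ 1#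
  isZero-yes {x} x≡0 with x ≟ 0#
  ... | yes _ = refl
  ... | no x≢0 = ⊥-elim (x≢0 x≡0)

  isZero-no : ∀ {x} → ¬ (x ≡ 0#) → isZero x ≡ 0#
  isZero-no {x} x≢0 with x ≟ 0#
  ... | yes x≡0 = ⊥-elim (x≢0 x≡0)
  ... | no _ = refl

module Transposition {n : ℕ} (i j : Fin n) where

  transpose-i : PC.transpose i j i ≡ j
  transpose-i rewrite dec-true (i FinP.≟ i) refl = refl

  transpose-j : PC.transpose i j j ≡ i
  transpose-j with j FinP.≟ i
  ... | yes j≡i = j≡i
  ... | no _ rewrite dec-true (j FinP.≟ j) refl = refl

  transpose-other : ∀ {k} → ¬ (k ≡ i) → ¬ (k ≡ j) → PC.transpose i j k ≡ k
  transpose-other {k} k≢i k≢j rewrite dec-false (k FinP.≟ i) k≢i | dec-false (k FinP.≟ j) k≢j = refl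

  transpose-involutive : ∀ k → PC.transpose i j (PC.transpose i j k) ≡ k
  transpose-involutive k = byCases k (k FinP.≟ i) (k FinP.≟ j)
    where
      byCases : ∀ k → Dec (k ≡ i) → Dec (k ≡ j) → PC.transpose i j (PC.transpose i j k) ≡ k
      byCases k (yes refl) _ = trans (cong (PC.transpose i j) transpose-i) transpose-j
      byCases k (no _) (yes refl) = trans (cong (PC.transpose i j) transpose-j) transpose-i
      byCases k (no k≢i) (no k≢j) =
        trans (cong (PC.transpose i j) (transpose-other k≢i k≢j)) (transpose-other k≢i k≢j)

transpose-self : ∀ {n} (i k : Fin n) → PC.transpose i i k ≡ k
transpose-self i k = byCases k (k FinP.≟ i)
  where
    open Transposition i i
    byCases : ∀ k → Dec (k ≡ i) → PC.transpose i i k ≡ k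
    byCases k (yes refl) = transpose-i
    byCases k (no k≢i) = transpose-other k≢i k≢i

-- An explicit list of all permutations of Fin n: a permutation of Fin (suc n)
-- is a permutation of the last n points followed by moving 0 to some k.
movingZeroTo : ∀ {n} → Fin (suc n) → List (Permutation′ n) → List (Permutation′ (suc n))
movingZeroTo k = map (λ ρ → lift₀ ρ Perm.∘ₚ Perm.transpose zero k)

allPermutations : (n : ℕ) → List (Permutation′ n)
allPermutations zero    = Perm.id ∷ []
allPermutations (suc n) = concatMap (λ k → movingZeroTo k (allPermutations n)) (allFin (suc n))

allPermutations-complete : ∀ {n} (ρ : Permutation′ n) → Any (Perm._≈ ρ) (allPermutations n)
allPermutations-complete {zero}  ρ = here (λ ())
allPermutations-complete {suc n} ρ =
  concatMap⁺ (λ k → movingZeroTo k (allPermutations n))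
    (Any.map (λ { refl → map⁺ (Any.map lift-correct (allPermutations-complete ρ′)) }) (∈-allFin k))
  where
    open Transposition zero (ρ ⟨$⟩ʳ zero)
    k = ρ ⟨$⟩ʳ zero
    -- ρ followed by the transposition (0 k) fixes 0, so it is a lifted permutation
    ρ₀ : Permutation′ (suc n)
    ρ₀ = ρ Perm.∘ₚ Perm.transpose zero k
    ρ′ = remove zero ρ₀
    lift-correct : ∀ {σ} → σ Perm.≈ ρ′ → (lift₀ σ Perm.∘ₚ Perm.transpose zero k) Perm.≈ ρ
    lift-correct {σ} σ≈ρ′ i = begin
        PC.transpose zero k (lift₀ σ ⟨$⟩ʳ i)                       ≡⟨ cong (PC.transpose zero k) (lift₀-cong σ ρ′ σ≈ρ′ i) ⟩
        PC.transpose zero k (lift₀ ρ′ ⟨$⟩ʳ i)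
          ≡⟨ cong (PC.transpose zero k) (lift₀-remove ρ₀ transpose-j i) ⟩
        PC.transpose zero k (PC.transpose zero k (ρ ⟨$⟩ʳ i))       ≡⟨ transpose-involutive _ ⟩
        ρ ⟨$⟩ʳ i                                                   ∎
      where open ≡-Reasoning

module FiniteSums {c : Level} (K : OrderedField c) where
  open OrderedFieldTheory K

  Σ[_] : ∀ {n} → (Fin n → Carrier) → Carrier
  Σ[_] = sumF K

  sum-cong : ∀ {n} {f g : Fin n → Carrier} → (∀ i → f i ≡ g i) → Σ[ f ] ≡ Σ[ g ]
  sum-cong {zero}  f≗g = refl
  sum-cong {suc n} f≗g = cong₂ _+_ (f≗g zero) (sum-cong (λ i → f≗g (suc i)))

  sum-+ : ∀ {n} (f g : Fin n → Carrier) → Σ[ (λ i → f i + g i) ] ≡ Σ[ f ] + Σ[ g ]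
  sum-+ {zero}  f g = sym (+-identityˡ 0#)
  sum-+ {suc n} f g = trans (cong (f zero + g zero +_) (sum-+ (λ i → f (suc i)) (λ i → g (suc i))))
    (solve 4 (λ a b x y → a :+ b :+ (x :+ y) := a :+ x :+ (b :+ y)) refl _ _ _ _)

  sum-*ˡ : ∀ {n} a (f : Fin n → Carrier) → Σ[ (λ i → a * f i) ] ≡ a * Σ[ f ]
  sum-*ˡ {zero}  a f = sym (zeroʳ a)
  sum-*ˡ {suc n} a f = trans (cong (a * f zero +_) (sum-*ˡ a (λ i → f (suc i)))) (sym (distribˡ _ _ _))

  sum-*ʳ : ∀ {n} a (f : Fin n → Carrier) → Σ[ (λ i → f i * a) ] ≡ Σ[ f ] * a
  sum-*ʳ a f = trans (sum-cong (λ i → *-comm (f i) a)) (trans (sum-*ˡ a f) (*-comm a _))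

  sum-neg : ∀ {n} (f : Fin n → Carrier) → Σ[ (λ i → - f i) ] ≡ - Σ[ f ]
  sum-neg {zero}  f = sym -0#≈0#
  sum-neg {suc n} f = trans (cong (- f zero +_) (sum-neg (λ i → f (suc i)))) (⁻¹-∙-comm _ _)

  sum-- : ∀ {n} (f g : Fin n → Carrier) → Σ[ (λ i → f i - g i) ] ≡ Σ[ f ] - Σ[ g ]
  sum-- f g = trans (sum-+ f (λ i → - g i)) (cong (Σ[ f ] +_) (sum-neg g))

  sum-zero : ∀ {n} {f : Fin n → Carrier} → (∀ i → f i ≡ 0#) → Σ[ f ] ≡ 0#
  sum-zero {zero}  f≗0 = refl
  sum-zero {suc n} f≗0 = trans (cong₂ _+_ (f≗0 zero) (sum-zero (λ i → f≗0 (suc i)))) (+-identityˡ 0#)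

  sum-mono : ∀ {n} {f g : Fin n → Carrier} → (∀ i → f i ≤ g i) → Σ[ f ] ≤ Σ[ g ]
  sum-mono {zero}  f≤g = ≤-refl
  sum-mono {suc n} f≤g = +-mono-≤ (f≤g zero) (sum-mono (λ i → f≤g (suc i)))

  sum-nonneg : ∀ {n} {f : Fin n → Carrier} → (∀ i → 0# ≤ f i) → 0# ≤ Σ[ f ]
  sum-nonneg {n} {f} 0≤f = subst (_≤ Σ[ f ]) (sum-zero {n} {λ _ → 0#} (λ _ → refl)) (sum-mono 0≤f)

  nonneg-sum-zero : ∀ {n} {f : Fin n → Carrier} → (∀ i → 0# ≤ f i) → Σ[ f ] ≡ 0# → ∀ i → f i ≡ 0#
  nonneg-sum-zero {suc n} 0≤f Σf≡0 i with nonneg-+-zero (0≤f zero) (sum-nonneg (λ i → 0≤f (suc i))) Σf≡0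
  nonneg-sum-zero {suc n} 0≤f Σf≡0 zero    | f0≡0 , _    = f0≡0
  nonneg-sum-zero {suc n} 0≤f Σf≡0 (suc i) | _ , rest≡0 = nonneg-sum-zero (λ i → 0≤f (suc i)) rest≡0 i

  sum-swap : ∀ {m n} (f : Fin m → Fin n → Carrier) → Σ[ (λ a → Σ[ f a ]) ] ≡ Σ[ (λ j → Σ[ (λ a → f a j) ]) ]
  sum-swap {zero}  {n} f = sym (sum-zero {n} (λ _ → refl))
  sum-swap {suc m} f = trans (cong (Σ[ f zero ] +_) (sum-swap (λ a → f (suc a))))
                             (sym (sum-+ (f zero) (λ j → Σ[ (λ a → f (suc a) j) ])))

  sum-extract : ∀ {n} (k : Fin (suc n)) (f : Fin (suc n) → Carrier) → Σ[ f ] ≡ f k + Σ[ (λ j → f (punchIn k j)) ]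
  sum-extract zero    f = refl
  sum-extract {suc n} (suc k) f = trans (cong (f zero +_) (sum-extract k (λ i → f (suc i))))
    (solve 3 (λ a b x → a :+ (b :+ x) := b :+ (a :+ x)) refl _ _ _)

  sum-permute : ∀ {n} (ρ : Permutation′ n) (f : Fin n → Carrier) → Σ[ (λ i → f (ρ ⟨$⟩ʳ i)) ] ≡ Σ[ f ]
  sum-permute {zero}  ρ f = refl
  sum-permute {suc n} ρ f = begin
      f ρ₀ + Σ[ (λ i → f (ρ ⟨$⟩ʳ suc i)) ]
        ≡⟨ cong (f ρ₀ +_) (sum-cong (λ i → cong f (punchIn-permute ρ zero i))) ⟩
      f ρ₀ + Σ[ (λ i → f (punchIn ρ₀ (remove zero ρ ⟨$⟩ʳ i))) ]
        ≡⟨ cong (f ρ₀ +_) (sum-permute (remove zero ρ) (λ j → f (punchIn ρ₀ j))) ⟩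
      f ρ₀ + Σ[ (λ j → f (punchIn ρ₀ j)) ]                     ≡⟨ sym (sum-extract ρ₀ f) ⟩
      Σ[ f ]                                                   ∎
    where
      open ≡-Reasoning
      ρ₀ = ρ ⟨$⟩ʳ zero

  sum-permuteˡ : ∀ {n} (ρ : Permutation′ n) (f : Fin n → Carrier) → Σ[ (λ i → f (ρ ⟨$⟩ˡ i)) ] ≡ Σ[ f ]
  sum-permuteˡ ρ = sum-permute (Perm.flip ρ)

  sum-single : ∀ {n} (a : Fin n) (f : Fin n → Carrier) → (∀ i → ¬ (i ≡ a) → f i ≡ 0#) → Σ[ f ] ≡ f a
  sum-single {suc n} a f f≗0 =
    trans (sum-extract a f) (trans (cong (f a +_) (sum-zero (λ j → f≗0 _ (FinP.punchInᵢ≢i a j)))) (+-identityʳ _))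

  sum-pair : ∀ {n} (a b : Fin n) (f : Fin n → Carrier) → ¬ (a ≡ b) →
             (∀ i → ¬ (i ≡ a) → ¬ (i ≡ b) → f i ≡ 0#) → Σ[ f ] ≡ f a + f b
  sum-pair {suc n} a b f a≢b f≗0 = begin
      Σ[ f ]                             ≡⟨ sum-extract a f ⟩
      f a + Σ[ (λ j → f (punchIn a j)) ] ≡⟨ cong (f a +_) (sum-single b′ (λ j → f (punchIn a j)) others≗0) ⟩
      f a + f (punchIn a b′)             ≡⟨ cong (λ z → f a + f z) (FinP.punchIn-punchOut a≢b) ⟩
      f a + f b                          ∎
    where
      open ≡-Reasoning
      b′ = punchOut a≢b
      others≗0 : ∀ j → ¬ (j ≡ b′) → f (punchIn a j) ≡ 0#
      others≗0 j j≢b′ = f≗0 _ (FinP.punchInᵢ≢i a j)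
        (λ e → j≢b′ (FinP.punchIn-injective a j b′ (trans e (sym (FinP.punchIn-punchOut a≢b)))))

  Monotone : ∀ {n} → (Fin n → Carrier) → Set c
  Monotone f = ∀ i j → i Fin.< j → f i ≤ f j

  StepMonotone : ∀ {n} → (Fin (suc n) → Carrier) → Set c
  StepMonotone f = ∀ k → f (inject₁ k) ≤ f (suc k)

  inject₁<suc : ∀ {n} (k : Fin n) → inject₁ k Fin.< suc k
  inject₁<suc k = s≤s (ℕP.≤-reflexive (FinP.toℕ-inject₁ k))

  monotone⇒step : ∀ {n} {f : Fin (suc n) → Carrier} → Monotone f → StepMonotone f
  monotone⇒step mono k = mono _ _ (inject₁<suc k)

  step⇒monotone≤ : ∀ {n} (f : Fin (suc n) → Carrier) → StepMonotone f → ∀ i j → i Fin.≤ j → f i ≤ f j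
  step⇒monotone≤ f step zero zero _ = ≤-refl
  step⇒monotone≤ {suc n} f step zero (suc j) _ =
    ≤-trans (step zero) (step⇒monotone≤ (λ i → f (suc i)) (λ k → step (suc k)) zero j z≤n)
  step⇒monotone≤ {suc n} f step (suc i) (suc j) (s≤s i≤j) =
    step⇒monotone≤ (λ i → f (suc i)) (λ k → step (suc k)) i j i≤j

  step⇒monotone : ∀ {n} {f : Fin (suc n) → Carrier} → StepMonotone f → Monotone f
  step⇒monotone {f = f} step i j i<j = step⇒monotone≤ f step i j (ℕP.<⇒≤ i<j)

  monotone≤ : ∀ {n} {f : Fin n → Carrier} → Monotone f → ∀ i j → i Fin.≤ j → f i ≤ f j
  monotone≤ {suc n} {f} mono = step⇒monotone≤ f (monotone⇒step mono)

  transpose-gain : ∀ {n} (x c : Fin n → Carrier) (a b : Fin n) → ¬ (a ≡ b) →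
                   Σ[ (λ i → x i * c (PC.transpose a b i)) ] - Σ[ (λ i → x i * c i) ] ≡ (x b - x a) * (c a - c b)
  transpose-gain x c a b a≢b = begin
      Σ[ g ] - Σ[ f ]                 ≡⟨ sym (sum-- g f) ⟩
      Σ[ (λ i → g i - f i) ]          ≡⟨ sum-pair a b (λ i → g i - f i) a≢b unchanged ⟩
      (g a - f a) + (g b - f b)       ≡⟨ cong₂ (λ p q → (x a * c p - f a) + (x b * c q - f b)) transpose-i transpose-j ⟩
      (x a * c b - x a * c a) + (x b * c a - x b * c b)
                                      ≡⟨ solve 4 (λ xa xb ca cb → (xa :* cb :- xa :* ca) :+ (xb :* ca :- xb :* cb)
                                                                 := (xb :- xa) :* (ca :- cb)) refl _ _ _ _ ⟩
      (x b - x a) * (c a - c b)       ∎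
    where
      open ≡-Reasoning
      open Transposition a b
      f g : Fin _ → Carrier
      f i = x i * c i
      g i = x i * c (PC.transpose a b i)
      unchanged : ∀ i → ¬ (i ≡ a) → ¬ (i ≡ b) → g i - f i ≡ 0#
      unchanged i i≢a i≢b = trans (cong (λ k → x i * c k - f i) (transpose-other i≢a i≢b)) (-‿inverseʳ (f i))

  exchange-gain : ∀ {n} (x c : Fin (suc n) → Carrier) (ρ : Permutation′ (suc n)) (m : Fin (suc n)) →
                  ¬ (zero ≡ m) → ρ ⟨$⟩ʳ m ≡ zero →
                  (c m - c zero) * (x (ρ ⟨$⟩ʳ zero) - x zero)
                    ≡ Σ[ (λ i → x (ρ ⟨$⟩ʳ PC.transpose zero m i) * c i) ] - Σ[ (λ i → x (ρ ⟨$⟩ʳ i) * c i) ]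
  exchange-gain x c ρ m 0≢m ρm≡0 = begin
      (c m - c zero) * (y zero - x zero)   ≡⟨ cong (λ q → (c m - c zero) * (y zero - x q)) (sym ρm≡0) ⟩
      (c m - c zero) * (y zero - y m)      ≡⟨ sym (transpose-gain c y zero m 0≢m) ⟩
      Σ[ (λ i → c i * y (PC.transpose zero m i)) ] - Σ[ (λ i → c i * y i) ]
                                           ≡⟨ cong₂ _-_ (sum-cong (λ i → *-comm (c i) (y (PC.transpose zero m i)))) (sum-cong (λ i → *-comm (c i) (y i))) ⟩
      Σ[ (λ i → y (PC.transpose zero m i) * c i) ] - Σ[ (λ i → y i * c i) ] ∎
    where
      open ≡-Reasoning
      y = λ i → x (ρ ⟨$⟩ʳ i)

  -- Rearrangement inequality: for increasing x and c, Σ x(ρ i) c(i) ≤ Σ x(i) c(i).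
  -- First make ρ fix 0 (which can only increase the sum), then recurse on the rest.
  rearrangement : ∀ {n} (x c : Fin n → Carrier) → Monotone x → Monotone c → (ρ : Permutation′ n) →
                  Σ[ (λ i → x (ρ ⟨$⟩ʳ i) * c i) ] ≤ Σ[ (λ i → x i * c i) ]
  rearrangement {zero}  x c x↑ c↑ ρ = ≤-refl
  rearrangement {suc n} x c x↑ c↑ ρ = begin
      Σ[ (λ i → x (ρ ⟨$⟩ʳ i) * c i) ]                                        ≤⟨ fix-zero-improves ⟩
      Σ[ (λ i → x (ρ₀ ⟨$⟩ʳ i) * c i) ]                                       ≡⟨ ρ₀-fixes-zero ⟩
      x zero * c zero + Σ[ (λ i → x (suc (ρ′ ⟨$⟩ʳ i)) * c (suc i)) ]         ≤⟨ recurse ⟩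
      Σ[ (λ i → x i * c i) ]                                                 ∎
    where
      open ≤-Reasoning
      m = ρ ⟨$⟩ˡ zero
      open Transposition zero m
      ρ₀ : Permutation′ (suc n)
      ρ₀ = Perm.transpose zero m Perm.∘ₚ ρ
      ρ₀0≡0 : ρ₀ ⟨$⟩ʳ zero ≡ zero
      ρ₀0≡0 = trans (cong (ρ ⟨$⟩ʳ_) transpose-i) (inverseʳ ρ)
      ρ′ = remove zero ρ₀
      fix-zero-improves : Σ[ (λ i → x (ρ ⟨$⟩ʳ i) * c i) ] ≤ Σ[ (λ i → x (ρ₀ ⟨$⟩ʳ i) * c i) ]
      fix-zero-improves with zero FinP.≟ m
      ... | yes 0≡m = ≡⇒≤ (sum-cong λ i → cong (λ k → x (ρ ⟨$⟩ʳ k) * c i)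
                        (sym (subst (λ m → PC.transpose zero m i ≡ i) 0≡m (transpose-self zero i))))
      ... | no 0≢m = 0≤-⇒≤ (subst (0# ≤_) (exchange-gain x c ρ m 0≢m (inverseʳ ρ)) (*-nonneg (≤⇒0≤- (monotone≤ c↑ zero m z≤n))
                                                                (≤⇒0≤- (monotone≤ x↑ zero _ z≤n))))

      ρ₀-fixes-zero : Σ[ (λ i → x (ρ₀ ⟨$⟩ʳ i) * c i) ] ≡ x zero * c zero + Σ[ (λ i → x (suc (ρ′ ⟨$⟩ʳ i)) * c (suc i)) ]
      ρ₀-fixes-zero = cong₂ _+_ (cong (λ k → x k * c zero) ρ₀0≡0)
        (sum-cong (λ i → cong (λ k → x k * c (suc i))
          (trans (punchIn-permute ρ₀ zero i) (cong (λ z → punchIn z (ρ′ ⟨$⟩ʳ i)) ρ₀0≡0))))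
      recurse : x zero * c zero + Σ[ (λ i → x (suc (ρ′ ⟨$⟩ʳ i)) * c (suc i)) ] ≤ Σ[ (λ i → x i * c i) ]
      recurse = +-monoˡ-≤ (x zero * c zero)
        (rearrangement (λ i → x (suc i)) (λ i → c (suc i)) (λ i j i<j → x↑ _ _ (s≤s i<j)) (λ i j i<j → c↑ _ _ (s≤s i<j)) ρ′)

  differences : ∀ {n} → (Fin (suc n) → Carrier) → Fin n → Carrier
  differences f k = f (suc k) - f (inject₁ k)

  tailSums : ∀ {n} → (Fin (suc n) → Carrier) → Fin n → Carrier
  tailSums z zero    = Σ[ (λ i → z (suc i)) ]
  tailSums z (suc k) = tailSums (λ i → z (suc i)) k

  abel-summation : ∀ {n} (x z : Fin (suc n) → Carrier) →
                   Σ[ (λ i → x i * z i) ] ≡ x zero * Σ[ z ] + Σ[ (λ k → differences x k * tailSums z k) ]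
  abel-summation {zero} x z =
    solve 2 (λ a b → a :* b :+ con (pos 0) := a :* (b :+ con (pos 0)) :+ con (pos 0)) refl (x zero) (z zero)
  abel-summation {suc n} x z = begin
      x zero * z zero + Σ[ (λ i → x (suc i) * z (suc i)) ]
        ≡⟨ cong (x zero * z zero +_) (abel-summation (λ i → x (suc i)) (λ i → z (suc i))) ⟩
      x zero * z zero + (x (suc zero) * T + R)
        ≡⟨ solve 5 (λ x0 x1 z0 t r → x0 :* z0 :+ (x1 :* t :+ r) := x0 :* (z0 :+ t) :+ ((x1 :- x0) :* t :+ r))
                   refl _ _ _ _ _ ⟩
      x zero * (z zero + T) + ((x (suc zero) - x zero) * T + R) ∎
    where
      open ≡-Reasoning
      T = Σ[ (λ i → z (suc i)) ]
      R = Σ[ (λ k → differences (λ i → x (suc i)) k * tailSums (λ i → z (suc i)) k) ]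

  -- b padded with 0 on both sides: padded b k = b_{k-1}, and 0 for k = 0 or k > n
  padded : ∀ {n} → (Fin n → Carrier) → ℕ → Carrier
  padded b zero    = 0#
  padded b (suc k) = at K b k

  summation-by-parts : ∀ {n} (x : Fin (suc n) → Carrier) (b : Fin n → Carrier) →
    Σ[ (λ i → x i * (padded b (toℕ i) - padded b (suc (toℕ i)))) ] ≡ Σ[ (λ k → differences x k * b k) ]
  summation-by-parts {zero} x b =
    solve 1 (λ a → a :* (con (pos 0) :- con (pos 0)) :+ con (pos 0) := con (pos 0)) refl (x zero)
  summation-by-parts {suc n} x b = begin
      x zero * (0# - b zero) + (x (suc zero) * (b zero - at K b′ zero) + R)
        ≡⟨ solve 5 (λ x0 x1 b0 a r → x0 :* (con (pos 0) :- b0) :+ (x1 :* (b0 :- a) :+ r)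
                                    := (x1 :- x0) :* b0 :+ (x1 :* (con (pos 0) :- a) :+ r)) refl _ _ _ _ _ ⟩
      (x (suc zero) - x zero) * b zero + (x (suc zero) * (0# - at K b′ zero) + R)
        ≡⟨ cong ((x (suc zero) - x zero) * b zero +_) (summation-by-parts (λ i → x (suc i)) b′) ⟩
      (x (suc zero) - x zero) * b zero + Σ[ (λ k → differences (λ i → x (suc i)) k * b′ k) ] ∎
    where
      open ≡-Reasoning
      b′ : Fin n → Carrier
      b′ i = b (suc i)
      R = Σ[ (λ i → x (suc (suc i)) * (padded b′ (suc (toℕ i)) - padded b′ (suc (suc (toℕ i))))) ]

  prepend0 : ∀ {n} → (Fin n → Carrier) → Fin (suc n) → Carrier
  prepend0 f zero    = 0#
  prepend0 f (suc i) = f i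

  prepend0-monotone : ∀ {n} {E : Fin n → Carrier} → Monotone E → (∀ m → 0# ≤ E m) → Monotone (prepend0 E)
  prepend0-monotone E↑ 0≤E zero    (suc j) _         = 0≤E j
  prepend0-monotone E↑ 0≤E (suc i) (suc j) (s≤s i<j) = E↑ i j i<j

  monotone-prepend0 : ∀ {n} {E : Fin n → Carrier} → Monotone (prepend0 E) → Monotone E × (∀ m → 0# ≤ E m)
  monotone-prepend0 mono = (λ i j i<j → mono (suc i) (suc j) (s≤s i<j)) , (λ j → mono zero (suc j) (s≤s z≤n))

  partialSums : ∀ {n} → (Fin n → Carrier) → Fin (suc n) → Carrier
  partialSums f zero = 0#
  partialSums {suc n} f (suc i) = f zero + partialSums (λ j → f (suc j)) i

  differences-partialSums : ∀ {n} (f : Fin n → Carrier) k → differences (partialSums f) k ≡ f k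
  differences-partialSums f zero = solve 1 (λ a → a :+ con (pos 0) :- con (pos 0) := a) refl (f zero)
  differences-partialSums {suc n} f (suc k) =
    trans (solve 3 (λ a p q → a :+ p :- (a :+ q) := p :- q) refl _ _ _) (differences-partialSums (λ j → f (suc j)) k)

  unitVector : ∀ {n} → Fin n → Fin n → Carrier
  unitVector a j with j FinP.≟ a
  ... | yes _ = 1#
  ... | no _  = 0#

  unitVector-nonneg : ∀ {n} (a j : Fin n) → 0# ≤ unitVector a j
  unitVector-nonneg a j with j FinP.≟ a
  ... | yes _ = <⇒≤ 0<1
  ... | no _  = ≤-refl

  sum-unitVector : ∀ {n} (a : Fin n) (f : Fin n → Carrier) → Σ[ (λ j → unitVector a j * f j) ] ≡ f a
  sum-unitVector a f = trans (sum-single a _ off-a) (at-a a)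
    where
      off-a : ∀ i → ¬ (i ≡ a) → unitVector a i * f i ≡ 0#
      off-a i i≢a with i FinP.≟ a
      ... | yes i≡a = ⊥-elim (i≢a i≡a)
      ... | no _    = zeroˡ (f i)
      at-a : ∀ i → unitVector i i * f i ≡ f i
      at-a i with i FinP.≟ i
      ... | yes _  = *-identityˡ (f i)
      ... | no i≢i = ⊥-elim (i≢i refl)

  ⟨_∣_⟩ : ∀ {n} → Pt K n → Pt K n → Carrier
  ⟨ w ∣ z ⟩ = ⟨_,_⟩ K w z

  pairing-cong : ∀ {n} (w : Pt K n) {z z′ : Pt K n} → (∀ i → z i ≡ z′ i) → ⟨ w ∣ z ⟩ ≡ ⟨ w ∣ z′ ⟩
  pairing-cong w z≗z′ = sum-cong (λ i → cong (w i *_) (z≗z′ i))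

  pairing-comm : ∀ {n} (w z : Pt K n) → ⟨ w ∣ z ⟩ ≡ ⟨ z ∣ w ⟩
  pairing-comm w z = sum-cong (λ i → *-comm (w i) (z i))

  pairing-- : ∀ {n} (w z z′ : Pt K n) → ⟨ w ∣ (λ i → z i - z′ i) ⟩ ≡ ⟨ w ∣ z ⟩ - ⟨ w ∣ z′ ⟩
  pairing-- w z z′ = trans (sum-cong (λ i → a[y-x]≡ay-ax (w i) (z′ i) (z i))) (sum-- (λ i → w i * z i) (λ i → w i * z′ i))

  -- an element maximising f over the list (the default x₀ if the list is empty)
  argmax : ∀ {a} {A : Set a} (f : A → Carrier) → A → (xs : List A) → Σ A (λ m → All (λ x → f x ≤ f m) xs)
  argmax f x₀ [] = x₀ , []
  argmax f x₀ (x ∷ xs) with argmax f x₀ xs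
  ... | m , f≤fm with ≤-total (f m) (f x)
  ...   | inj₁ fm≤fx = x , (≤-refl ∷ All.map (λ p → ≤-trans p fm≤fx) f≤fm)
  ...   | inj₂ fx≤fm = m , (fx≤fm ∷ f≤fm)

-- Facet coordinates of the cone σ(π,τ).  Nothing here depends on α, β, M, N.
module ConeCoordinates {c : Level} (K : OrderedField c) {d : ℕ} where
  open OrderedFieldTheory K
  open FiniteSums K

  sorted : Permutation′ (suc d) → Pt K (suc d) → Fin (suc d) → Carrier
  sorted π w i = w (π ⟨$⟩ˡ i)

  gaps : Permutation′ (suc d) → Permutation′ d → Pt K (suc d) → Fin d → Carrier
  gaps π τ w m = Δ K π w (τ ⟨$⟩ˡ m)

  -- the d facet functionals of σ(π,τ): the first gap and the increments of
  -- consecutive gaps; σ(π,τ) is exactly the set where all are ≥ 0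
  facet : Permutation′ (suc d) → Permutation′ d → Pt K (suc d) → Fin d → Carrier
  facet π τ w = differences (prepend0 (gaps π τ w))

  -- the coordinates dual to the facets, on points z of V_d (Σ z = 0)
  dualCoord : Permutation′ (suc d) → Permutation′ d → Pt K (suc d) → Fin d → Carrier
  dualCoord π τ z = tailSums (prepend0 (λ m → tailSums (sorted π z) (τ ⟨$⟩ˡ m)))

  -- ⟨w,z⟩ = Σ_j facet_j(w) · dualCoord_j(z) for Σ z = 0: two Abel summations,
  -- first along π, then along τ.
  pairing-facets : ∀ π τ w z → Σ[ z ] ≡ 0# → ⟨ w ∣ z ⟩ ≡ Σ[ (λ j → facet π τ w j * dualCoord π τ z j) ]
  pairing-facets π τ w z Σz≡0 = begin
      ⟨ w ∣ z ⟩                                         ≡⟨ sym (sum-permuteˡ π (λ a → w a * z a)) ⟩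
      Σ[ (λ i → sorted π w i * sorted π z i) ]          ≡⟨ abel-summation (sorted π w) (sorted π z) ⟩
      sorted π w zero * Σ[ sorted π z ] + R
        ≡⟨ cong (λ s → sorted π w zero * s + R) (trans (sum-permuteˡ π z) Σz≡0) ⟩
      sorted π w zero * 0# + R
        ≡⟨ solve 2 (λ a r → a :* con (pos 0) :+ r := r) refl (sorted π w zero) R ⟩
      R                                                 ≡⟨ sym (sum-permuteˡ τ (λ k → Δ K π w k * tailSums (sorted π z) k)) ⟩
      Σ[ (λ m → gaps π τ w m * T m) ]                   ≡⟨ solve 1 (λ r → r := con (pos 0) :* con (pos 0) :+ r) refl _ ⟩
      Σ[ (λ i → prepend0 (gaps π τ w) i * prepend0 T i) ] ≡⟨ abel-summation (prepend0 (gaps π τ w)) (prepend0 T) ⟩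
      0# * Σ[ prepend0 T ] + Σ[ (λ j → facet π τ w j * dualCoord π τ z j) ]
                                                        ≡⟨ solve 2 (λ a r → con (pos 0) :* a :+ r := r) refl _ _ ⟩
      Σ[ (λ j → facet π τ w j * dualCoord π τ z j) ]    ∎
    where
      open ≡-Reasoning
      R = Σ[ (λ k → Δ K π w k * tailSums (sorted π z) k) ]
      T = λ m → tailSums (sorted π z) (τ ⟨$⟩ˡ m)

  -- σ(π,τ) = { w : facet_j(w) ≥ 0 for all j }: nonnegative increments and a
  -- nonnegative first gap make all gaps nonnegative and increasing
  facets-nonneg⇒σ : ∀ π τ w → (∀ j → 0# ≤ facet π τ w j) → σ K π τ w
  facets-nonneg⇒σ π τ w 0≤facet = sorted-monotone , gaps-monotone
    where
      prepend0-gaps-monotone : Monotone (gaps π τ w) × (∀ m → 0# ≤ gaps π τ w m)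
      prepend0-gaps-monotone = monotone-prepend0 (step⇒monotone (λ k → 0≤-⇒≤ (0≤facet k)))
      gaps-monotone = proj₁ prepend0-gaps-monotone
      0≤gaps = proj₂ prepend0-gaps-monotone
      sorted-monotone : Monotone (sorted π w)
      sorted-monotone = step⇒monotone (λ k → 0≤-⇒≤ (subst (0# ≤_) (cong (Δ K π w) (inverseˡ τ)) (0≤gaps (τ ⟨$⟩ʳ k))))

  σ⇒facets-nonneg : ∀ π τ w → σ K π τ w → ∀ j → 0# ≤ facet π τ w j
  σ⇒facets-nonneg π τ w (sorted-monotone , gaps-monotone) j =
    ≤⇒0≤- (monotone⇒step (prepend0-monotone gaps-monotone 0≤gaps) j)
    where
      0≤gaps : ∀ m → 0# ≤ gaps π τ w m
      0≤gaps m = ≤⇒0≤- (monotone⇒step sorted-monotone (τ ⟨$⟩ˡ m))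

  -- the functional with prescribed facet values ℓ (obtained by integrating twice)
  withFacets : Permutation′ (suc d) → Permutation′ d → (Fin d → Carrier) → Pt K (suc d)
  withFacets π τ ℓ a = partialSums (λ k → partialSums ℓ (suc (τ ⟨$⟩ʳ k))) (π ⟨$⟩ʳ a)

  facet-withFacets : ∀ π τ ℓ j → facet π τ (withFacets π τ ℓ) j ≡ ℓ j
  facet-withFacets π τ ℓ j = trans (cong₂ _-_ (prepend0-gaps (suc j)) (prepend0-gaps (inject₁ j)))
                                   (differences-partialSums ℓ j)
    where
      w = withFacets π τ ℓ
      G = λ k → partialSums ℓ (suc (τ ⟨$⟩ʳ k))
      sorted-w : ∀ i → sorted π w i ≡ partialSums G i
      sorted-w i = cong (partialSums G) (inverseʳ π)
      gaps-w : ∀ m → gaps π τ w m ≡ partialSums ℓ (suc m)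
      gaps-w m = begin
          sorted π w (suc k) - sorted π w (inject₁ k)     ≡⟨ cong₂ _-_ (sorted-w (suc k)) (sorted-w (inject₁ k)) ⟩
          differences (partialSums G) k                   ≡⟨ differences-partialSums G k ⟩
          partialSums ℓ (suc (τ ⟨$⟩ʳ k))                  ≡⟨ cong (λ q → partialSums ℓ (suc q)) (inverseʳ τ) ⟩
          partialSums ℓ (suc m)                           ∎
        where
          open ≡-Reasoning
          k = τ ⟨$⟩ˡ m
      prepend0-gaps : ∀ i → prepend0 (gaps π τ w) i ≡ partialSums ℓ i
      prepend0-gaps zero    = refl
      prepend0-gaps (suc m) = gaps-w m

  ray : Permutation′ (suc d) → Permutation′ d → Fin d → Pt K (suc d)
  ray π τ j = withFacets π τ (unitVector j)

  ray∈σ : ∀ π τ j → σ K π τ (ray π τ j)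
  ray∈σ π τ j = facets-nonneg⇒σ π τ (ray π τ j)
    (λ k → subst (0# ≤_) (sym (facet-withFacets π τ (unitVector j) k)) (unitVector-nonneg j k))

  pairing-ray : ∀ π τ j z → Σ[ z ] ≡ 0# → ⟨ ray π τ j ∣ z ⟩ ≡ dualCoord π τ z j
  pairing-ray π τ j z Σz≡0 = begin
      ⟨ ray π τ j ∣ z ⟩                                             ≡⟨ pairing-facets π τ (ray π τ j) z Σz≡0 ⟩
      Σ[ (λ k → facet π τ (ray π τ j) k * dualCoord π τ z k) ]
        ≡⟨ sum-cong (λ k → cong (_* dualCoord π τ z k) (facet-withFacets π τ (unitVector j) k)) ⟩
      Σ[ (λ k → unitVector j k * dualCoord π τ z k) ]               ≡⟨ sum-unitVector j (dualCoord π τ z) ⟩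
      dualCoord π τ z j                                             ∎
    where open ≡-Reasoning

  Tight : Permutation′ (suc d) → Permutation′ d → Pt K (suc d) → Pt K (suc d) → Set c
  Tight π τ w₀ w = ∀ j → facet π τ w₀ j ≡ 0# → facet π τ w j ≡ 0#

  -- A face of σ(π,τ) cut out by u ∈ V_d with u ≥ 0 on σ(π,τ) is the set of
  -- w ∈ σ(π,τ) tight on the facets containing faceSelector u, the point lying
  -- exactly on the facets j with dualCoord_j(u) ≠ 0.
  faceSelector : Permutation′ (suc d) → Permutation′ d → Pt K (suc d) → Pt K (suc d)
  faceSelector π τ u = withFacets π τ (λ j → isZero (dualCoord π τ u j))

  faceSelector∈σ : ∀ π τ u → σ K π τ (faceSelector π τ u)
  faceSelector∈σ π τ u = facets-nonneg⇒σ π τ (faceSelector π τ u)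
    (λ j → subst (0# ≤_) (sym (facet-withFacets π τ _ j)) (isZero-nonneg (dualCoord π τ u j)))

  coneFace⇔tight : ∀ π τ u → Σ[ u ] ≡ 0# → (∀ w → σ K π τ w → 0# ≤ ⟨ u ∣ w ⟩) →
                   ∀ w → (σ K π τ w × ⟨ u ∣ w ⟩ ≡ 0#) ⇔ (σ K π τ w × Tight π τ (faceSelector π τ u) w)
  coneFace⇔tight π τ u Σu≡0 u≥0 w = mk⇔ to from
    where
      U = dualCoord π τ u
      U≥0 : ∀ j → 0# ≤ U j
      U≥0 j = subst (0# ≤_) (trans (pairing-comm u (ray π τ j)) (pairing-ray π τ j u Σu≡0)) (u≥0 (ray π τ j) (ray∈σ π τ j))
      selects : ∀ j → facet π τ (faceSelector π τ u) j ≡ isZero (U j)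
      selects = facet-withFacets π τ _
      term = λ j → facet π τ w j * U j
      pairing-u : ⟨ u ∣ w ⟩ ≡ Σ[ term ]
      pairing-u = trans (pairing-comm u w) (pairing-facets π τ w u Σu≡0)
      to : σ K π τ w × ⟨ u ∣ w ⟩ ≡ 0# → σ K π τ w × Tight π τ (faceSelector π τ u) w
      to (w∈σ , cut) = w∈σ , λ j selected≡0 →
        [ id , (λ U≡0 → ⊥-elim (nontrivial (trans (sym selected≡0) (trans (selects j) (isZero-yes U≡0))))) ]′
        (*-zero (nonneg-sum-zero {f = term} (λ j → *-nonneg (σ⇒facets-nonneg π τ w w∈σ j) (U≥0 j)) (trans (sym pairing-u) cut) j))
      from : σ K π τ w × Tight π τ (faceSelector π τ u) w → σ K π τ w × ⟨ u ∣ w ⟩ ≡ 0#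
      from (w∈σ , tight) = w∈σ , trans pairing-u (sum-zero (λ j → term≡0 j (U j ≟ 0#)))
        where
          term≡0 : ∀ j → Dec (U j ≡ 0#) → term j ≡ 0#
          term≡0 j (yes U≡0) = trans (cong (facet π τ w j *_) U≡0) (zeroʳ _)
          term≡0 j (no U≢0)  = trans (cong (_* U j) (tight j (trans (selects j) (isZero-no U≢0)))) (zeroˡ _)

normalCone-cong : ∀ {c} {K : OrderedField c} {n} {P F G : Pt K n → Set c} →
                  (∀ x → F x ⇔ G x) → ∀ w → NormalCone K P F w ⇔ NormalCone K P G w
normalCone-cong F⇔G w = mk⇔ (λ w∈N x x∈G → w∈N x (Equivalence.from (F⇔G x) x∈G))
                            (λ w∈N x x∈F → w∈N x (Equivalence.to (F⇔G x) x∈F))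

-- The vertices v_{π,τ} of Perm(α,β;M,N).  Only the positivity of N, the
-- monotonicity of β and the appropriateness of (M,N) are needed.
module NestedVertices {c : Level} (K : OrderedField c) {d : ℕ}
    (α : Fin (suc d) → OrderedField.Carrier K) (β : Fin d → OrderedField.Carrier K)
    (M N : OrderedField.Carrier K)
    (β↑ : StrictlyIncreasing K β) (0<N : OrderedField._<_ K (OrderedField.0# K) N)
    (appropriate : Nested.Appropriate K α β M N) where

  open OrderedFieldTheory K
  open FiniteSums K
  open ConeCoordinates K {d}
  open Nested K α β M N using (Bτ; coeff; v)

  pairing-vertex : ∀ π τ w → ⟨ w ∣ v π τ ⟩ ≡ Σ[ (λ i → sorted π w i * coeff τ i) ]
  pairing-vertex π τ w = trans (sym (sum-permuteˡ π (λ a → w a * coeff τ (π ⟨$⟩ʳ a))))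
                               (sum-cong (λ i → cong (λ q → sorted π w i * coeff τ q) (inverseʳ π {i})))

  Bτ≡padded : ∀ τ k → Bτ τ k ≡ padded (λ j → β (τ ⟨$⟩ʳ j)) k
  Bτ≡padded τ zero    = refl
  Bτ≡padded τ (suc k) = refl

  coeff-expansion : ∀ (x : Fin (suc d) → Carrier) τ →
    Σ[ (λ i → x i * coeff τ i) ] ≡ M * Σ[ (λ i → x i * α i) ] + N * Σ[ (λ k → differences x k * β (τ ⟨$⟩ʳ k)) ]
  coeff-expansion x τ = begin
      Σ[ (λ i → x i * coeff τ i) ]
        ≡⟨ sum-cong (λ i → solve 6 (λ xi m ai n p q → xi :* (m :* ai :+ n :* (p :- q)) := m :* (xi :* ai) :+ n :* (xi :* (p :- q)))
                                   refl (x i) M (α i) N (Bτ τ (toℕ i)) (Bτ τ (suc (toℕ i)))) ⟩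
      Σ[ (λ i → M * (x i * α i) + N * bpart i) ]
        ≡⟨ sum-+ (λ i → M * (x i * α i)) (λ i → N * bpart i) ⟩
      Σ[ (λ i → M * (x i * α i)) ] + Σ[ (λ i → N * bpart i) ]
        ≡⟨ cong₂ _+_ (sum-*ˡ M (λ i → x i * α i)) (sum-*ˡ N bpart) ⟩
      M * Σ[ (λ i → x i * α i) ] + N * Σ[ bpart ]
        ≡⟨ cong (λ q → M * Σ[ (λ i → x i * α i) ] + N * q)
             (trans (sum-cong (λ i → cong₂ (λ p q → x i * (p - q)) (Bτ≡padded τ (toℕ i)) (Bτ≡padded τ (suc (toℕ i)))))
                    (summation-by-parts x (λ j → β (τ ⟨$⟩ʳ j)))) ⟩
      M * Σ[ (λ i → x i * α i) ] + N * Σ[ (λ k → differences x k * β (τ ⟨$⟩ʳ k)) ] ∎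
    where
      open ≡-Reasoning
      bpart = λ i → x i * (Bτ τ (toℕ i) - Bτ τ (suc (toℕ i)))

  reorder-gaps : ∀ π τ w (g : Fin d → Carrier) →
                 Σ[ (λ k → Δ K π w k * g (τ ⟨$⟩ʳ k)) ] ≡ Σ[ (λ m → gaps π τ w m * g m) ]
  reorder-gaps π τ w g = trans (sym (sum-permuteˡ τ (λ k → Δ K π w k * g (τ ⟨$⟩ʳ k))))
                               (sum-cong (λ m → cong (λ q → gaps π τ w m * g q) (inverseʳ τ {m})))

  pairing-vertex-expansion : ∀ π τ w →
    ⟨ w ∣ v π τ ⟩ ≡ M * Σ[ (λ i → sorted π w i * α i) ] + N * Σ[ (λ m → gaps π τ w m * β m) ]
  pairing-vertex-expansion π τ w = begin
      ⟨ w ∣ v π τ ⟩                                     ≡⟨ pairing-vertex π τ w ⟩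
      Σ[ (λ i → sorted π w i * coeff τ i) ]             ≡⟨ coeff-expansion (sorted π w) τ ⟩
      M * A + N * Σ[ (λ k → Δ K π w k * β (τ ⟨$⟩ʳ k)) ] ≡⟨ cong (λ q → M * A + N * q) (reorder-gaps π τ w β) ⟩
      M * A + N * Σ[ (λ m → gaps π τ w m * β m) ]       ∎
    where
      open ≡-Reasoning
      A = Σ[ (λ i → sorted π w i * α i) ]

  -- For w ∈ σ(π,τ), v_{π,τ} maximises ⟨w,-⟩ among all v_{π',τ'}: by the
  -- rearrangement inequality, once for the coordinates (against the increasing
  -- coefficients of v_{π',τ'}) and once for the gaps (against β).
  vertex-maximal : ∀ π τ w → σ K π τ w → ∀ π′ τ′ → ⟨ w ∣ v π′ τ′ ⟩ ≤ ⟨ w ∣ v π τ ⟩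
  vertex-maximal π τ w (sorted↑ , gaps↑) π′ τ′ = begin
      ⟨ w ∣ v π′ τ′ ⟩                             ≡⟨ pairing-vertex π′ τ′ w ⟩
      Σ[ (λ i → sorted π′ w i * coeff τ′ i) ]
        ≡⟨ sum-cong (λ i → cong (λ q → w q * coeff τ′ i) (sym (inverseˡ π {π′ ⟨$⟩ˡ i}))) ⟩
      Σ[ (λ i → sorted π w (ρ ⟨$⟩ʳ i) * coeff τ′ i) ]
                                                  ≤⟨ rearrangement (sorted π w) (coeff τ′) sorted↑ (λ i j i<j → <⇒≤ (appropriate τ′ i j i<j)) ρ ⟩
      Σ[ (λ i → sorted π w i * coeff τ′ i) ]      ≡⟨ coeff-expansion (sorted π w) τ′ ⟩
      M * A + N * Σ[ (λ k → Δ K π w k * β (τ′ ⟨$⟩ʳ k)) ]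
                                                  ≡⟨ cong (λ q → M * A + N * q) (reorder-gaps π τ′ w β) ⟩
      M * A + N * Σ[ (λ m → gaps π τ′ w m * β m) ]
                                                  ≡⟨ cong (λ q → M * A + N * q) (sum-cong (λ m → cong (λ q → Δ K π w q * β m) (sym (inverseˡ τ {τ′ ⟨$⟩ˡ m})))) ⟩
      M * A + N * Σ[ (λ m → gaps π τ w (ρ′ ⟨$⟩ʳ m) * β m) ]
                                                  ≤⟨ +-monoˡ-≤ (M * A) (*-monoˡ-≤ (<⇒≤ 0<N)
                                                       (rearrangement (gaps π τ w) β gaps↑ (λ i j i<j → <⇒≤ (β↑ i j i<j)) ρ′)) ⟩
      M * A + N * Σ[ (λ m → gaps π τ w m * β m) ] ≡⟨ sym (pairing-vertex-expansion π τ w) ⟩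
      ⟨ w ∣ v π τ ⟩                               ∎
    where
      open ≤-Reasoning
      A = Σ[ (λ i → sorted π w i * α i) ]
      ρ : Permutation′ (suc d)
      ρ = Perm.flip π′ Perm.∘ₚ π
      ρ′ : Permutation′ d
      ρ′ = Perm.flip τ′ Perm.∘ₚ τ

  -- The d neighbours of v_{π,τ} across the facets of σ(π,τ): for j = 0 swap
  -- two consecutive entries of π, otherwise swap the entries j-1, j of τ.
  neighbour : Permutation′ (suc d) → Permutation′ d → Fin d → Permutation′ (suc d) × Permutation′ d
  neighbour π τ zero    = π Perm.∘ₚ Perm.transpose (inject₁ (τ ⟨$⟩ˡ zero)) (suc (τ ⟨$⟩ˡ zero)) , τ
  neighbour π τ (suc j) = π , τ Perm.∘ₚ Perm.transpose (inject₁ j) (suc j)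

  neighbourVertex : Permutation′ (suc d) → Permutation′ d → Fin d → Pt K (suc d)
  neighbourVertex π τ j = v (proj₁ (neighbour π τ j)) (proj₂ (neighbour π τ j))

  edgeFactor : Permutation′ d → Fin d → Carrier
  edgeFactor τ zero    = coeff τ (suc (τ ⟨$⟩ˡ zero)) - coeff τ (inject₁ (τ ⟨$⟩ˡ zero))
  edgeFactor τ (suc j) = N * (β (suc j) - β (inject₁ j))

  edgeFactor-pos : ∀ τ j → 0# < edgeFactor τ j
  edgeFactor-pos τ zero    = <⇒0<- (appropriate τ _ _ (inject₁<suc (τ ⟨$⟩ˡ zero)))
  edgeFactor-pos τ (suc j) = *-pos 0<N (<⇒0<- (β↑ _ _ (inject₁<suc j)))

  transpose-loss : ∀ {n} (x e : Fin n → Carrier) (a b : Fin n) → ¬ (a ≡ b) →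
                   Σ[ (λ i → x i * e i) ] - Σ[ (λ i → x i * e (PC.transpose a b i)) ] ≡ (e b - e a) * (x b - x a)
  transpose-loss x e a b a≢b = begin
      Σ[ f ] - Σ[ g ]               ≡⟨ solve 2 (λ p q → p :- q := :- (q :- p)) refl Σ[ f ] Σ[ g ] ⟩
      - (Σ[ g ] - Σ[ f ])           ≡⟨ cong -_ (transpose-gain x e a b a≢b) ⟩
      - ((x b - x a) * (e a - e b)) ≡⟨ solve 4 (λ xa xb ea eb → :- ((xb :- xa) :* (ea :- eb)) := (eb :- ea) :* (xb :- xa))
                                             refl (x a) (x b) (e a) (e b) ⟩
      (e b - e a) * (x b - x a)     ∎
    where
      open ≡-Reasoning
      f = λ i → x i * e i
      g = λ i → x i * e (PC.transpose a b i)

  neighbour-difference : ∀ π τ w j → ⟨ w ∣ v π τ ⟩ - ⟨ w ∣ neighbourVertex π τ j ⟩ ≡ edgeFactor τ j * facet π τ w j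
  neighbour-difference π τ w zero = begin
      ⟨ w ∣ v π τ ⟩ - ⟨ w ∣ v π′ τ ⟩   ≡⟨ cong₂ _-_ (pairing-vertex π τ w) swapped ⟩
      Σ[ (λ i → x i * coeff τ i) ] - Σ[ (λ i → x i * coeff τ (PC.transpose a b i)) ]
                                      ≡⟨ transpose-loss x (coeff τ) a b (FinP.<⇒≢ (inject₁<suc k)) ⟩
      edgeFactor τ zero * (x b - x a) ≡⟨ cong (edgeFactor τ zero *_) (x-0 (x b - x a)) ⟩
      edgeFactor τ zero * facet π τ w zero ∎
    where
      open ≡-Reasoning
      k = τ ⟨$⟩ˡ zero
      a = inject₁ k
      b = suc k
      x = sorted π w
      π′ = proj₁ (neighbour π τ zero)
      swapped : ⟨ w ∣ v π′ τ ⟩ ≡ Σ[ (λ i → x i * coeff τ (PC.transpose a b i)) ]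
      swapped = trans (sym (sum-permuteˡ π (λ y → w y * coeff τ (PC.transpose a b (π ⟨$⟩ʳ y)))))
                      (sum-cong (λ i → cong (λ q → x i * coeff τ (PC.transpose a b q)) (inverseʳ π {i})))
      x-0 : ∀ y → y ≡ y - 0#
      x-0 y = sym (trans (cong (y +_) -0#≈0#) (+-identityʳ y))
  neighbour-difference π τ w (suc j) = begin
      ⟨ w ∣ v π τ ⟩ - ⟨ w ∣ v π τ′ ⟩
        ≡⟨ cong₂ _-_ (pairing-vertex-expansion π τ w) (pairing-vertex-expansion π τ′ w) ⟩
      (M * A + N * Σ[ (λ m → E m * β m) ]) - (M * A + N * Σ[ (λ m → gaps π τ′ w m * β m) ])
        ≡⟨ cong (λ s → (M * A + N * Σ[ (λ m → E m * β m) ]) - (M * A + N * s)) τ′-gaps ⟩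
      (M * A + N * Σ[ (λ m → E m * β m) ]) - (M * A + N * Σ[ (λ m → E m * β (PC.transpose a b m)) ])
        ≡⟨ solve 5 (λ m a n p q → (m :* a :+ n :* p) :- (m :* a :+ n :* q) := n :* (p :- q)) refl M A N _ _ ⟩
      N * (Σ[ (λ m → E m * β m) ] - Σ[ (λ m → E m * β (PC.transpose a b m)) ])
        ≡⟨ cong (N *_) (transpose-loss E β a b (FinP.<⇒≢ (inject₁<suc j))) ⟩
      N * ((β b - β a) * (E b - E a))
        ≡⟨ sym (*-assoc N _ _) ⟩
      edgeFactor τ (suc j) * facet π τ w (suc j) ∎
    where
      open ≡-Reasoning
      a = inject₁ j
      b = suc j
      τ′ = proj₂ (neighbour π τ (suc j))
      E = gaps π τ w
      A = Σ[ (λ i → sorted π w i * α i) ]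
      τ′-gaps : Σ[ (λ m → gaps π τ′ w m * β m) ] ≡ Σ[ (λ m → E m * β (PC.transpose a b m)) ]
      τ′-gaps = trans (sym (reorder-gaps π τ′ w β)) (reorder-gaps π τ w (λ m → β (PC.transpose a b m)))

  -- Conversely, if v_{π,τ} is at least as good as all its neighbours, then
  -- all facet values are ≥ 0, i.e. w ∈ σ(π,τ).
  maximal⇒σ : ∀ π τ w → (∀ π′ τ′ → ⟨ w ∣ v π′ τ′ ⟩ ≤ ⟨ w ∣ v π τ ⟩) → σ K π τ w
  maximal⇒σ π τ w v-max = facets-nonneg⇒σ π τ w (λ j →
    pos-*-nonneg⇒nonneg (edgeFactor-pos τ j)
      (subst (0# ≤_) (neighbour-difference π τ w j) (≤⇒0≤- (v-max (proj₁ (neighbour π τ j)) (proj₂ (neighbour π τ j))))))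

  vertexSum : Carrier
  vertexSum = M * Σ[ (λ i → 1# * α i) ]

  vertex-sum : ∀ π τ → Σ[ v π τ ] ≡ vertexSum
  vertex-sum π τ = begin
      Σ[ v π τ ]                   ≡⟨ sum-cong (λ a → sym (*-identityˡ (v π τ a))) ⟩
      ⟨ (λ _ → 1#) ∣ v π τ ⟩       ≡⟨ pairing-vertex-expansion π τ (λ _ → 1#) ⟩
      vertexSum + N * Σ[ (λ m → (1# - 1#) * β m) ]
                                   ≡⟨ cong (λ q → vertexSum + N * q) (sum-zero (λ m → trans (cong (_* β m) (-‿inverseʳ 1#)) (zeroˡ _))) ⟩
      vertexSum + N * 0#           ≡⟨ solve 2 (λ a n → a :+ n :* con (pos 0) := a) refl vertexSum N ⟩
      vertexSum                    ∎
    where open ≡-Reasoning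

  at-cong : ∀ {n} {f g : Fin n → Carrier} → (∀ i → f i ≡ g i) → ∀ k → at K f k ≡ at K g k
  at-cong {zero}  f≗g k       = refl
  at-cong {suc n} f≗g zero    = f≗g zero
  at-cong {suc n} f≗g (suc k) = at-cong (λ i → f≗g (suc i)) k

  v-cong : ∀ {π₁ π₂ τ₁ τ₂} → π₁ Perm.≈ π₂ → τ₁ Perm.≈ τ₂ → ∀ a → v π₁ τ₁ a ≡ v π₂ τ₂ a
  v-cong {π₁} {π₂} {τ₁} {τ₂} π₁≈π₂ τ₁≈τ₂ a =
    trans (cong (coeff τ₁) (π₁≈π₂ a)) (cong₂ (λ p q → M * α i + N * (p - q)) (B-cong (toℕ i)) (B-cong (suc (toℕ i))))
    where
      i = π₂ ⟨$⟩ʳ a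
      B-cong : ∀ k → Bτ τ₁ k ≡ Bτ τ₂ k
      B-cong zero    = refl
      B-cong (suc k) = at-cong (λ j → cong β (τ₁≈τ₂ j)) k

  vertexList : List (Permutation′ (suc d) × Permutation′ d)
  vertexList = cartesianProduct (allPermutations (suc d)) (allPermutations d)

  vertexList-complete : ∀ π τ → Any ((Perm._≈ π) ⟨×⟩ (Perm._≈ τ)) vertexList
  vertexList-complete π τ = cartesianProduct⁺ (allPermutations-complete π) (allPermutations-complete τ)

  vertexOf : Permutation′ (suc d) × Permutation′ d → Pt K (suc d)
  vertexOf (π , τ) = v π τ

  -- Every w lies in some σ(π,τ): take a vertex maximising ⟨w,-⟩.
  σ-covers : ∀ w → Σ (Permutation′ (suc d)) (λ π → Σ (Permutation′ d) (λ τ → σ K π τ w))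
  σ-covers w = π , τ , maximal⇒σ π τ w v-max
    where
      best = argmax (λ q → ⟨ w ∣ vertexOf q ⟩) (Perm.id , Perm.id) vertexList
      π = proj₁ (proj₁ best)
      τ = proj₂ (proj₁ best)
      v-max : ∀ π′ τ′ → ⟨ w ∣ v π′ τ′ ⟩ ≤ ⟨ w ∣ v π τ ⟩
      v-max π′ τ′ = All.lookupWith
        (λ {q} q-worse (π≈ , τ≈) → subst (_≤ ⟨ w ∣ v π τ ⟩) (pairing-cong w (v-cong {proj₁ q} {π′} {proj₂ q} {τ′} π≈ τ≈)) q-worse)
        (proj₂ best) (vertexList-complete π′ τ′)

  -- The functional Σ_j [facet_j(w₀) = 0] (v_{π,τ} - v_j), summing the edge
  -- vectors towards the neighbours across the facets containing w₀; on
  -- σ(π,τ) it is ≥ 0 and vanishes exactly on the w tight at those facets.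
  facetCut : Permutation′ (suc d) → Permutation′ d → Pt K (suc d) → Pt K (suc d)
  facetCut π τ w₀ a = Σ[ (λ j → isZero (facet π τ w₀ j) * (v π τ a - neighbourVertex π τ j a)) ]

  facetCut-sum : ∀ π τ w₀ → Σ[ facetCut π τ w₀ ] ≡ 0#
  facetCut-sum π τ w₀ = begin
      Σ[ (λ a → Σ[ (λ j → onFacet j * edge j a) ]) ] ≡⟨ sum-swap (λ a j → onFacet j * edge j a) ⟩
      Σ[ (λ j → Σ[ (λ a → onFacet j * edge j a) ]) ] ≡⟨ sum-cong (λ j → sum-*ˡ (onFacet j) (edge j)) ⟩
      Σ[ (λ j → onFacet j * Σ[ edge j ]) ]           ≡⟨ sum-zero (λ j → trans (cong (onFacet j *_) (edge-sum j)) (zeroʳ _)) ⟩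
      0#                                             ∎
    where
      open ≡-Reasoning
      onFacet = λ j → isZero (facet π τ w₀ j)
      edge = λ j a → v π τ a - neighbourVertex π τ j a
      edge-sum : ∀ j → Σ[ edge j ] ≡ 0#
      edge-sum j = trans (sum-- (v π τ) (neighbourVertex π τ j))
        (trans (cong₂ _-_ (vertex-sum π τ) (vertex-sum (proj₁ (neighbour π τ j)) (proj₂ (neighbour π τ j))))
               (-‿inverseʳ vertexSum))

  cutTerm : Permutation′ (suc d) → Permutation′ d → Pt K (suc d) → Pt K (suc d) → Fin d → Carrier
  cutTerm π τ w₀ w j = isZero (facet π τ w₀ j) * (edgeFactor τ j * facet π τ w j)

  pairing-facetCut : ∀ π τ w₀ w → ⟨ facetCut π τ w₀ ∣ w ⟩ ≡ Σ[ cutTerm π τ w₀ w ]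
  pairing-facetCut π τ w₀ w = begin
      Σ[ (λ a → Σ[ (λ j → onFacet j * edge j a) ] * w a) ]
        ≡⟨ sum-cong (λ a → trans (sym (sum-*ʳ (w a) (λ j → onFacet j * edge j a))) (sum-cong (λ j → *-assoc (onFacet j) _ (w a)))) ⟩
      Σ[ (λ a → Σ[ (λ j → onFacet j * (edge j a * w a)) ]) ]
        ≡⟨ sum-swap (λ a j → onFacet j * (edge j a * w a)) ⟩
      Σ[ (λ j → Σ[ (λ a → onFacet j * (edge j a * w a)) ]) ]
        ≡⟨ sum-cong (λ j → sum-*ˡ (onFacet j) (λ a → edge j a * w a)) ⟩
      Σ[ (λ j → onFacet j * ⟨ edge j ∣ w ⟩) ]
        ≡⟨ sum-cong (λ j → cong (onFacet j *_) (trans (pairing-comm (edge j) w)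
             (trans (pairing-- w (v π τ) (neighbourVertex π τ j)) (neighbour-difference π τ w j)))) ⟩
      Σ[ cutTerm π τ w₀ w ] ∎
    where
      open ≡-Reasoning
      onFacet = λ j → isZero (facet π τ w₀ j)
      edge = λ j a → v π τ a - neighbourVertex π τ j a

  cutTerm-nonneg : ∀ π τ w₀ w → σ K π τ w → ∀ j → 0# ≤ cutTerm π τ w₀ w j
  cutTerm-nonneg π τ w₀ w w∈σ j =
    *-nonneg (isZero-nonneg _) (*-nonneg (<⇒≤ (edgeFactor-pos τ j)) (σ⇒facets-nonneg π τ w w∈σ j))

  facetCut-nonneg : ∀ π τ w₀ w → σ K π τ w → 0# ≤ ⟨ facetCut π τ w₀ ∣ w ⟩
  facetCut-nonneg π τ w₀ w w∈σ = subst (0# ≤_) (sym (pairing-facetCut π τ w₀ w)) (sum-nonneg (cutTerm-nonneg π τ w₀ w w∈σ))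

  tight⇔facetCut : ∀ π τ w₀ w → (σ K π τ w × Tight π τ w₀ w) ⇔ (σ K π τ w × ⟨ facetCut π τ w₀ ∣ w ⟩ ≡ 0#)
  tight⇔facetCut π τ w₀ w = mk⇔ to from
    where
      to : σ K π τ w × Tight π τ w₀ w → σ K π τ w × ⟨ facetCut π τ w₀ ∣ w ⟩ ≡ 0#
      to (w∈σ , tight) = w∈σ , trans (pairing-facetCut π τ w₀ w) (sum-zero (λ j → term≡0 j (facet π τ w₀ j ≟ 0#)))
        where
          term≡0 : ∀ j → Dec (facet π τ w₀ j ≡ 0#) → cutTerm π τ w₀ w j ≡ 0#
          term≡0 j (yes facet₀≡0) = trans (cong (λ q → isZero (facet π τ w₀ j) * (edgeFactor τ j * q)) (tight j facet₀≡0))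
                                          (trans (cong (isZero (facet π τ w₀ j) *_) (zeroʳ _)) (zeroʳ _))
          term≡0 j (no facet₀≢0)  = trans (cong (_* (edgeFactor τ j * facet π τ w j)) (isZero-no facet₀≢0)) (zeroˡ _)
      -- a vanishing term with a selected facet forces facet_j(w) = 0, as edgeFactor_j > 0
      from : σ K π τ w × ⟨ facetCut π τ w₀ ∣ w ⟩ ≡ 0# → σ K π τ w × Tight π τ w₀ w
      from (w∈σ , cut) = w∈σ , λ j facet₀≡0 →
        nonzero-*-zero (λ e≡0 → <⇒≢ (edgeFactor-pos τ j) (sym e≡0))
          (trans (sym (*-identityˡ _)) (trans (cong (_* (edgeFactor τ j * facet π τ w j)) (sym (isZero-yes facet₀≡0)))
            (nonneg-sum-zero {f = cutTerm π τ w₀ w} (cutTerm-nonneg π τ w₀ w w∈σ) (trans (sym (pairing-facetCut π τ w₀ w)) cut) j)))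

  σ-faceOfItself : ∀ π τ → IsConeFace K (σ K π τ) (σ K π τ)
  σ-faceOfItself π τ = (λ _ → 0#) , sum-zero {suc d} {λ _ → 0#} (λ _ → refl) , (λ w _ → ≡⇒≤ (sym (pairing-zero w))) ,
                       (λ w → mk⇔ (λ w∈σ → w∈σ , pairing-zero w) proj₁)
    where
      pairing-zero : ∀ (w : Pt K (suc d)) → ⟨ (λ _ → 0#) ∣ w ⟩ ≡ 0#
      pairing-zero w = sum-zero (λ i → zeroˡ (w i))

  Br²-complete : Complete K (InBr² K d)
  Br²-complete w = cone (σ-covers w)
    where
      cone : Σ (Permutation′ (suc d)) (λ π → Σ (Permutation′ d) (λ τ → σ K π τ w)) →
             Σ (Pt K (suc d) → Set c) (λ C → InBr² K d C × C w)
      cone (π , τ , w∈σ) = σ K π τ , (π , τ , σ-faceOfItself π τ) , w∈σ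

  -- Perm(α,β;M,N) and conv of the vertex list are both such sets,
  -- and the vertex and normal-fan statements hold for any of them.
  record SpannedByVertices (Q : Pt K (suc d) → Set c) : Set c where
    field
      contains-vertices   : ∀ π τ → Q (v π τ)
      bounded-by-vertices : ∀ w m → (∀ π τ → ⟨ w ∣ v π τ ⟩ ≤ m) → ∀ y → Q y → ⟨ w ∣ y ⟩ ≤ m
      respects-≈          : ∀ x y → _≈ₚ_ K x y → Q x → Q y

  module Spanned {Q : Pt K (suc d) → Set c} (Q-spanned : SpannedByVertices Q) where
    open SpannedByVertices Q-spanned

    vertex-maximal-on-Q : ∀ π τ w → σ K π τ w → ∀ y → Q y → ⟨ w ∣ y ⟩ ≤ ⟨ w ∣ v π τ ⟩
    vertex-maximal-on-Q π τ w w∈σ = bounded-by-vertices w _ (vertex-maximal π τ w w∈σ)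

    -- Q lies in the hyperplane Σ x = vertexSum: bound ⟨1,-⟩ and ⟨-1,-⟩ by the vertices.
    Q-sum : ∀ y → Q y → Σ[ y ] ≡ vertexSum
    Q-sum y y∈Q = ≤-antisym (subst (_≤ vertexSum) (pairing-one y) upper)
                            (neg-reflects-≤ (subst (_≤ - vertexSum) (pairing-minus-one y) lower))
      where
        pairing-one : ∀ z → ⟨ (λ _ → 1#) ∣ z ⟩ ≡ Σ[ z ]
        pairing-one z = sum-cong (λ i → *-identityˡ (z i))
        pairing-minus-one : ∀ z → ⟨ (λ _ → - 1#) ∣ z ⟩ ≡ - Σ[ z ]
        pairing-minus-one z = trans (sum-cong (λ i → -1*x≈-x (z i))) (sum-neg z)
        upper = bounded-by-vertices (λ _ → 1#) vertexSum
                  (λ π τ → ≡⇒≤ (trans (pairing-one (v π τ)) (vertex-sum π τ))) y y∈Q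
        lower = bounded-by-vertices (λ _ → - 1#) (- vertexSum)
                  (λ π τ → ≡⇒≤ (trans (pairing-minus-one (v π τ)) (cong -_ (vertex-sum π τ)))) y y∈Q

    offset : Permutation′ (suc d) → Permutation′ d → Pt K (suc d) → Pt K (suc d)
    offset π τ y a = v π τ a - y a

    offset-sum : ∀ π τ y → Q y → Σ[ offset π τ y ] ≡ 0#
    offset-sum π τ y y∈Q = trans (sum-- (v π τ) y) (trans (cong₂ _-_ (vertex-sum π τ) (Q-sum y y∈Q)) (-‿inverseʳ vertexSum))

    gap-decomposition : ∀ π τ w y → Q y →
      ⟨ w ∣ v π τ ⟩ - ⟨ w ∣ y ⟩ ≡ Σ[ (λ j → facet π τ w j * dualCoord π τ (offset π τ y) j) ]
    gap-decomposition π τ w y y∈Q =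
      trans (sym (pairing-- w (v π τ) y)) (pairing-facets π τ w (offset π τ y) (offset-sum π τ y y∈Q))

    -- the dual coordinates of v - y are ≥ 0: pair with the rays of σ(π,τ)
    dualCoord-nonneg : ∀ π τ y → Q y → ∀ j → 0# ≤ dualCoord π τ (offset π τ y) j
    dualCoord-nonneg π τ y y∈Q j =
      subst (0# ≤_) (trans (sym (pairing-- r (v π τ) y)) (pairing-ray π τ j (offset π τ y) (offset-sum π τ y y∈Q)))
            (≤⇒0≤- (vertex-maximal-on-Q π τ r (ray∈σ π τ j) y y∈Q))
      where r = ray π τ j

    -- complementary slackness: if w ∈ σ(π,τ) and y ∈ Q is as good as v_{π,τ}
    -- for w, then every term facet_j(w) · dualCoord_j(v - y) vanishes
    slackness : ∀ π τ w → σ K π τ w → ∀ y → Q y → ⟨ w ∣ v π τ ⟩ ≡ ⟨ w ∣ y ⟩ →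
                ∀ j → facet π τ w j * dualCoord π τ (offset π τ y) j ≡ 0#
    slackness π τ w w∈σ y y∈Q same-value = nonneg-sum-zero {f = λ j → facet π τ w j * dualCoord π τ (offset π τ y) j}
      (λ j → *-nonneg (σ⇒facets-nonneg π τ w w∈σ j) (dualCoord-nonneg π τ y y∈Q j))
      (trans (sym (gap-decomposition π τ w y y∈Q)) (x≡y⇒x-y≡0 same-value))

    same-value-transfer : ∀ π τ w₀ w → σ K π τ w₀ → (∀ j → facet π τ w₀ j ≡ 0# → facet π τ w j ≡ 0#) →
                          ∀ y → Q y → ⟨ w₀ ∣ v π τ ⟩ ≡ ⟨ w₀ ∣ y ⟩ → ⟨ w ∣ v π τ ⟩ ≡ ⟨ w ∣ y ⟩
    same-value-transfer π τ w₀ w w₀∈σ tight y y∈Q same-value =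
      x-y≡0⇒x≡y (trans (gap-decomposition π τ w y y∈Q) (sum-zero {f = term} term≡0))
      where
        U = dualCoord π τ (offset π τ y)
        term = λ j → facet π τ w j * U j
        term≡0 : ∀ j → term j ≡ 0#
        term≡0 j = [ (λ facet₀≡0 → trans (cong (_* U j) (tight j facet₀≡0)) (zeroˡ _))
                   , (λ U≡0 → trans (cong (facet π τ w j *_) U≡0) (zeroʳ _))
                   ]′ (*-zero (slackness π τ w₀ w₀∈σ y y∈Q same-value j))

    -- Each v_{π,τ} is a vertex of Q: the functional with all facet values 1
    -- is maximised exactly there.
    vertex : ∀ π τ → IsVertex K Q (v π τ)
    vertex π τ = w* , λ x → mk⇔ (equal⇒maximiser x) (maximiser⇒equal x)
      where
        w* = withFacets π τ (λ _ → 1#)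
        w*∈σ : σ K π τ w*
        w*∈σ = facets-nonneg⇒σ π τ w* (λ j → subst (0# ≤_) (sym (facet-withFacets π τ _ j)) (<⇒≤ 0<1))
        equal⇒maximiser : ∀ x → _≈ₚ_ K x (v π τ) → Maximises K Q w* x
        equal⇒maximiser x x≈v = respects-≈ (v π τ) x (λ i → sym (x≈v i)) (contains-vertices π τ) ,
          λ y y∈Q → subst (⟨ w* ∣ y ⟩ ≤_) (pairing-cong w* (λ i → sym (x≈v i))) (vertex-maximal-on-Q π τ w* w*∈σ y y∈Q)
        -- no facet value of w* vanishes, so every coordinate functional agrees on x and v
        maximiser⇒equal : ∀ x → Maximises K Q w* x → _≈ₚ_ K x (v π τ)
        maximiser⇒equal x (x∈Q , x-max) a = sym (begin
            v π τ a                           ≡⟨ sym (sum-unitVector a (v π τ)) ⟩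
            ⟨ unitVector a ∣ v π τ ⟩          ≡⟨ same-value-transfer π τ w* (unitVector a) w*∈σ never-zero x x∈Q same-value ⟩
            ⟨ unitVector a ∣ x ⟩              ≡⟨ sum-unitVector a x ⟩
            x a                               ∎)
          where
            open ≡-Reasoning
            same-value = ≤-antisym (x-max (v π τ) (contains-vertices π τ)) (vertex-maximal-on-Q π τ w* w*∈σ x x∈Q)
            never-zero : ∀ j → facet π τ w* j ≡ 0# → facet π τ (unitVector a) j ≡ 0#
            never-zero j facet≡0 = ⊥-elim (nontrivial (trans (sym facet≡0) (facet-withFacets π τ _ j)))

    normalCone-vertex : ∀ π τ w → NormalCone K Q (λ x → _≈ₚ_ K x (v π τ)) w ⇔ σ K π τ w
    normalCone-vertex π τ w = mk⇔
      (λ w∈N → maximal⇒σ π τ w (λ π′ τ′ → w∈N (v π τ) (λ _ → refl) (v π′ τ′) (contains-vertices π′ τ′)))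
      (λ w∈σ x x≈v y y∈Q → subst (⟨ w ∣ y ⟩ ≤_) (pairing-cong w (λ i → sym (x≈v i))) (vertex-maximal-on-Q π τ w w∈σ y y∈Q))

    normalCone-face : ∀ π τ w₀ → σ K π τ w₀ → ∀ w →
                      NormalCone K Q (Maximises K Q w₀) w ⇔ (σ K π τ w × Tight π τ w₀ w)
    normalCone-face π τ w₀ w₀∈σ w = mk⇔ to from
      where
        v-max : Maximises K Q w₀ (v π τ)
        v-max = contains-vertices π τ , vertex-maximal-on-Q π τ w₀ w₀∈σ
        to : NormalCone K Q (Maximises K Q w₀) w → σ K π τ w × Tight π τ w₀ w
        to w∈N = w∈σ , tight
          where
            w∈σ = maximal⇒σ π τ w (λ π′ τ′ → w∈N (v π τ) v-max (v π′ τ′) (contains-vertices π′ τ′))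
            -- across a facet containing w₀ the neighbour also maximises w₀, so w
            -- takes the same value there and its facet value vanishes
            tight : Tight π τ w₀ w
            tight j facet₀≡0 = nonzero-*-zero (λ e≡0 → <⇒≢ (edgeFactor-pos τ j) (sym e≡0)) edge≡0
              where
                nb = neighbour π τ j
                same₀ : ⟨ w₀ ∣ v π τ ⟩ ≡ ⟨ w₀ ∣ neighbourVertex π τ j ⟩
                same₀ = x-y≡0⇒x≡y (trans (neighbour-difference π τ w₀ j) (trans (cong (edgeFactor τ j *_) facet₀≡0) (zeroʳ _)))
                nb-max : Maximises K Q w₀ (neighbourVertex π τ j)
                nb-max = contains-vertices (proj₁ nb) (proj₂ nb) ,
                         λ y y∈Q → ≤-trans (vertex-maximal-on-Q π τ w₀ w₀∈σ y y∈Q) (≡⇒≤ same₀)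
                edge≡0 : edgeFactor τ j * facet π τ w j ≡ 0#
                edge≡0 = trans (sym (neighbour-difference π τ w j))
                  (x≡y⇒x-y≡0 (≤-antisym (w∈N _ nb-max (v π τ) (contains-vertices π τ))
                                        (vertex-maximal π τ w w∈σ (proj₁ nb) (proj₂ nb))))
        from : σ K π τ w × Tight π τ w₀ w → NormalCone K Q (Maximises K Q w₀) w
        from (w∈σ , tight) x (x∈Q , x-max) y y∈Q =
          ≤-trans (vertex-maximal-on-Q π τ w w∈σ y y∈Q) (≡⇒≤ (same-value-transfer π τ w₀ w w₀∈σ tight x x∈Q same₀))
          where
            same₀ = ≤-antisym (x-max (v π τ) (contains-vertices π τ)) (vertex-maximal-on-Q π τ w₀ w₀∈σ x x∈Q)

    -- A cone of Br²_d (a face of σ(π,τ) cut by u) is the normal cone of the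
    -- face of Q maximising faceSelector u.
    Br²⇒normalFan : ∀ C → InBr² K d C → InNormalFan K Q C
    Br²⇒normalFan C (π , τ , u , Σu≡0 , u≥0 , C⇔cut) = Maximises K Q w₀ , (w₀ , λ x → mk⇔ id id) , C⇔normalCone
      where
        w₀ = faceSelector π τ u
        C⇔normalCone : ∀ w → C w ⇔ NormalCone K Q (Maximises K Q w₀) w
        C⇔normalCone w = ⇔.trans (C⇔cut w) (⇔.trans (coneFace⇔tight π τ u Σu≡0 u≥0 w)
                                                    (⇔.sym (normalCone-face π τ w₀ (faceSelector∈σ π τ u) w)))

    -- The normal cone of the face maximising w₀ ∈ σ(π,τ) is the face of σ(π,τ)
    -- cut by facetCut π τ w₀.
    normalFan⇒Br² : ∀ C → InNormalFan K Q C → InBr² K d C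
    normalFan⇒Br² C (F , (w₀ , F⇔max) , C⇔normalCone) =
      π , τ , facetCut π τ w₀ , facetCut-sum π τ w₀ , facetCut-nonneg π τ w₀ , C⇔cut
      where
        π = proj₁ (σ-covers w₀)
        τ = proj₁ (proj₂ (σ-covers w₀))
        w₀∈σ : σ K π τ w₀
        w₀∈σ = proj₂ (proj₂ (σ-covers w₀))
        C⇔cut : ∀ w → C w ⇔ (σ K π τ w × ⟨ facetCut π τ w₀ ∣ w ⟩ ≡ 0#)
        C⇔cut w = ⇔.trans (C⇔normalCone w) (⇔.trans (normalCone-cong {K = K} {P = Q} F⇔max w)
                    (⇔.trans (normalCone-face π τ w₀ w₀∈σ w) (tight⇔facetCut π τ w₀ w)))

    sameFan : SameFan K (InBr² K d) (InNormalFan K Q)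
    sameFan C = mk⇔ (Br²⇒normalFan C) (normalFan⇒Br² C)

-- Defs describes them by a weight
-- sum and a combination map over lists of (weight, label) pairs; we only use
-- their defining equations, so that the lemmas apply both to Perm(α,β;M,N)
-- (labels are pairs (π,τ)) and to Conv (labels are points).
module ConvexCombinations {c : Level} (K : OrderedField c) {n : ℕ} where
  open OrderedFieldTheory K
  open FiniteSums K

  record CombinationMaps {a} {A : Set a} (point : A → Pt K n)
                         (weightSum : List (Carrier × A) → Carrier)
                         (combine : List (Carrier × A) → Pt K n) : Set (a ⊔ c) where
    field
      weightSum-[] : weightSum [] ≡ 0#
      weightSum-∷  : ∀ l a ws → weightSum ((l , a) ∷ ws) ≡ l + weightSum ws
      combine-[]   : ∀ j → combine [] j ≡ 0#
      combine-∷    : ∀ l a ws j → combine ((l , a) ∷ ws) j ≡ l * point a j + combine ws j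

  module _ {a} {A : Set a} {point : A → Pt K n} {weightSum combine}
           (maps : CombinationMaps point weightSum combine) where
    open CombinationMaps maps

    combination-bound : ∀ w m ws → All (λ lp → 0# ≤ proj₁ lp) ws → All (λ lp → ⟨ w ∣ point (proj₂ lp) ⟩ ≤ m) ws →
                        ⟨ w ∣ combine ws ⟩ ≤ m * weightSum ws
    combination-bound w m [] [] [] = ≡⇒≤ (trans (sum-zero (λ j → trans (cong (w j *_) (combine-[] j)) (zeroʳ (w j))))
                                                (sym (trans (cong (m *_) weightSum-[]) (zeroʳ m))))
    combination-bound w m ((l , a) ∷ ws) (0≤l ∷ 0≤ws) (bound-a ∷ bound-ws) = begin
        ⟨ w ∣ combine ((l , a) ∷ ws) ⟩
          ≡⟨ sum-cong (λ j → trans (cong (w j *_) (combine-∷ l a ws j))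
               (solve 4 (λ x l′ p y → x :* (l′ :* p :+ y) := l′ :* (x :* p) :+ x :* y) refl (w j) l (point a j) (combine ws j))) ⟩
        Σ[ (λ j → l * (w j * point a j) + w j * combine ws j) ]
          ≡⟨ trans (sum-+ (λ j → l * (w j * point a j)) (λ j → w j * combine ws j))
                   (cong (_+ ⟨ w ∣ combine ws ⟩) (sum-*ˡ l (λ j → w j * point a j))) ⟩
        l * ⟨ w ∣ point a ⟩ + ⟨ w ∣ combine ws ⟩
          ≤⟨ +-mono-≤ (*-monoˡ-≤ 0≤l bound-a) (combination-bound w m ws 0≤ws bound-ws) ⟩
        l * m + m * weightSum ws
          ≡⟨ solve 3 (λ l′ m′ s → l′ :* m′ :+ m′ :* s := m′ :* (l′ :+ s)) refl l m (weightSum ws) ⟩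
        m * (l + weightSum ws)
          ≡⟨ cong (m *_) (sym (weightSum-∷ l a ws)) ⟩
        m * weightSum ((l , a) ∷ ws) ∎
      where open ≤-Reasoning

    convex-bound : ∀ w m ws → All (λ lp → 0# ≤ proj₁ lp) ws → weightSum ws ≡ 1# →
                   All (λ lp → ⟨ w ∣ point (proj₂ lp) ⟩ ≤ m) ws → ∀ y → _≈ₚ_ K y (combine ws) → ⟨ w ∣ y ⟩ ≤ m
    convex-bound w m ws 0≤ws Σws≡1 bounds y y≈comb =
      subst (_≤ m) (sym (pairing-cong w y≈comb))
            (subst (⟨ w ∣ combine ws ⟩ ≤_) (trans (cong (m *_) Σws≡1) (*-identityʳ m)) (combination-bound w m ws 0≤ws bounds))

  module _ {weightSum combine} (maps : CombinationMaps (λ p → p) weightSum combine) where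
    open CombinationMaps maps

    zeroWeights-sum : ∀ ps → weightSum (map (0# ,_) ps) ≡ 0#
    zeroWeights-sum []       = weightSum-[]
    zeroWeights-sum (p ∷ ps) = trans (weightSum-∷ _ _ _) (trans (cong (0# +_) (zeroWeights-sum ps)) (+-identityˡ 0#))

    zeroWeights-combine : ∀ ps j → combine (map (0# ,_) ps) j ≡ 0#
    zeroWeights-combine []       j = combine-[] j
    zeroWeights-combine (p ∷ ps) j = trans (combine-∷ _ _ _ j) (trans (cong₂ _+_ (zeroˡ _) (zeroWeights-combine ps j)) (+-identityˡ 0#))

    -- a listed point is the convex combination with weight 1 at its position
    member-convex : ∀ {x ps} (i : Any (_≈ₚ_ K x) ps) →
                    Σ (List (Carrier × Pt K n)) (λ ws → map proj₂ ws ≡ ps × All (λ lp → 0# ≤ proj₁ lp) ws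
                                                       × weightSum ws ≡ 1# × _≈ₚ_ K x (combine ws))
    member-convex {x} {p ∷ ps} (here x≈p) =
      (1# , p) ∷ map (0# ,_) ps ,
      cong (p ∷_) (trans (sym (ListP.map-∘ ps)) (ListP.map-id ps)) ,
      <⇒≤ 0<1 ∷ AllP.map⁺ (All.universal (λ _ → ≤-refl) ps) ,
      trans (weightSum-∷ _ _ _) (trans (cong (1# +_) (zeroWeights-sum ps)) (+-identityʳ 1#)) ,
      λ j → trans (x≈p j) (sym (trans (combine-∷ _ _ _ j) (trans (cong₂ _+_ (*-identityˡ _) (zeroWeights-combine ps j)) (+-identityʳ _))))
    member-convex {x} {p ∷ ps} (there i) = extend (member-convex i)
      where
        extend : Σ (List (Carrier × Pt K n)) (λ ws → map proj₂ ws ≡ ps × All (λ lp → 0# ≤ proj₁ lp) ws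
                                                  × weightSum ws ≡ 1# × _≈ₚ_ K x (combine ws)) →
                 Σ (List (Carrier × Pt K n)) (λ ws → map proj₂ ws ≡ p ∷ ps × All (λ lp → 0# ≤ proj₁ lp) ws
                                                  × weightSum ws ≡ 1# × _≈ₚ_ K x (combine ws))
        extend (ws , ws↦ps , 0≤ws , Σws≡1 , x≈comb) =
          (0# , p) ∷ ws ,
          cong (p ∷_) ws↦ps ,
          ≤-refl ∷ 0≤ws ,
          trans (weightSum-∷ _ _ _) (trans (cong (0# +_) Σws≡1) (+-identityˡ 1#)) ,
          λ j → trans (x≈comb j) (sym (trans (combine-∷ _ _ _ j) (trans (cong (_+ combine ws j) (zeroˡ _)) (+-identityˡ _))))

module Polytopes {c : Level} (K : OrderedField c) {d : ℕ}
    (α : Fin (suc d) → OrderedField.Carrier K) (β : Fin d → OrderedField.Carrier K)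
    (M N : OrderedField.Carrier K)
    (β↑ : StrictlyIncreasing K β) (0<N : OrderedField._<_ K (OrderedField.0# K) N)
    (appropriate : Nested.Appropriate K α β M N) where

  open OrderedFieldTheory K
  open FiniteSums K
  open ConvexCombinations K {suc d}
  open Nested K α β M N using (v; sumL; combL; PermPoly)
  open NestedVertices K α β M N β↑ 0<N appropriate

  permPoly-maps : CombinationMaps vertexOf sumL combL
  permPoly-maps = record { weightSum-[] = refl ; weightSum-∷ = λ _ _ _ → refl
                         ; combine-[] = λ _ → refl ; combine-∷ = λ _ _ _ _ → refl }

  permPoly-spanned : SpannedByVertices PermPoly
  permPoly-spanned = record
    { contains-vertices   = λ π τ → ((1# , π , τ) ∷ []) , (<⇒≤ 0<1 ∷ []) , +-identityʳ 1# ,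
                                    (λ j → sym (trans (+-identityʳ _) (*-identityˡ _)))
    ; bounded-by-vertices = λ { w m v-bound y (ws , 0≤ws , Σws≡1 , y≈comb) →
        convex-bound permPoly-maps w m ws 0≤ws Σws≡1 (All.universal (λ { (_ , π , τ) → v-bound π τ }) ws) y y≈comb }
    ; respects-≈          = λ { x y x≈y (ws , 0≤ws , Σws≡1 , x≈comb) →
        ws , 0≤ws , Σws≡1 , (λ j → trans (sym (x≈y j)) (x≈comb j)) }
    }

  vertexPoints : List (Pt K (suc d))
  vertexPoints = map vertexOf vertexList

  vertexPoints-sum : All (λ p → sumF K p ≡ vertexSum) vertexPoints
  vertexPoints-sum = AllP.map⁺ (All.universal (λ { (π , τ) → vertex-sum π τ }) vertexList)

  vertex-listed : ∀ π τ → Any (_≈ₚ_ K (v π τ)) vertexPoints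
  vertex-listed π τ =
    map⁺ (Any.map (λ { {π′ , τ′} (π′≈π , τ′≈τ) a → sym (v-cong {π′} {π} {τ′} {τ} π′≈π τ′≈τ a) }) (vertexList-complete π τ))

  -- Conv's weight sum and combination satisfy their defining equations by computation
  conv-spanned : SpannedByVertices (Conv K vertexPoints)
  conv-spanned = record
    { contains-vertices   = λ π τ → member-convex
        (record { weightSum-[] = refl ; weightSum-∷ = λ _ _ _ → refl ; combine-[] = λ _ → refl ; combine-∷ = λ _ _ _ _ → refl })
        (vertex-listed π τ)
    ; bounded-by-vertices = λ w m v-bound y y∈hull → hull-bound y∈hull
        (record { weightSum-[] = refl ; weightSum-∷ = λ _ _ _ → refl ; combine-[] = λ _ → refl ; combine-∷ = λ _ _ _ _ → refl })
        w m v-bound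
    ; respects-≈          = λ { x y x≈y (ws , ws↦ps , 0≤ws , Σws≡1 , x≈comb) →
        ws , ws↦ps , 0≤ws , Σws≡1 , (λ j → trans (sym (x≈y j)) (x≈comb j)) }
    }
    where
      hull-bound : ∀ {weightSum combine y} →
                   Σ (List (Carrier × Pt K (suc d))) (λ ws → map proj₂ ws ≡ vertexPoints × All (λ lp → 0# ≤ proj₁ lp) ws
                                                           × weightSum ws ≡ 1# × _≈ₚ_ K y (combine ws)) →
                   CombinationMaps (λ p → p) weightSum combine →
                   ∀ w m → (∀ π τ → ⟨ w ∣ v π τ ⟩ ≤ m) → ⟨ w ∣ y ⟩ ≤ m
      hull-bound {y = y} (ws , ws↦ps , 0≤ws , Σws≡1 , y≈comb) maps w m v-bound =
        convex-bound maps w m ws 0≤ws Σws≡1 listed-bound y y≈comb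
        where
          listed-bound : All (λ lp → ⟨ w ∣ proj₂ lp ⟩ ≤ m) ws
          listed-bound = AllP.map⁻ (subst (All (λ p → ⟨ w ∣ p ⟩ ≤ m)) (sym ws↦ps)
                                          (AllP.map⁺ (All.universal (λ { (π , τ) → v-bound π τ }) vertexList)))

proposition4p6 : ∀ {c : Level} (K : OrderedField c) (d : ℕ)
    (α : Fin (suc d) → OrderedField.Carrier K) (β : Fin d → OrderedField.Carrier K)
    (M N : OrderedField.Carrier K) →
    StrictlyIncreasing K α → StrictlyIncreasing K β →
    OrderedField._<_ K (OrderedField.0# K) M → OrderedField._<_ K (OrderedField.0# K) N →
    Nested.Appropriate K α β M N →
    ((∀ (π : Permutation′ (suc d)) (τ : Permutation′ d) →
        IsVertex K (Nested.PermPoly K α β M N) (Nested.v K α β M N π τ)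
        × (∀ w → NormalCone K (Nested.PermPoly K α β M N)
                   (λ x → _≈ₚ_ K x (Nested.v K α β M N π τ)) w
                 ⇔ σ K π τ w))
     × SameFan K (InBr² K d) (InNormalFan K (Nested.PermPoly K α β M N))
     × Complete K (InBr² K d)
     × Projective K (InBr² K d))
proposition4p6 K d α β M N _ β↑ _ 0<N appropriate =
    (λ π τ → PermPoly.vertex π τ , PermPoly.normalCone-vertex π τ)
  , PermPoly.sameFan
  , Br²-complete
  , (vertexPoints , vertexSum , vertexPoints-sum , Hull.sameFan)
  where
    open NestedVertices K α β M N β↑ 0<N appropriate
    open Polytopes K α β M N β↑ 0<N appropriate
    module PermPoly = Spanned permPoly-spanned
    module Hull = Spanned conv-spanned
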